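{- Let $m\ge1$, let $k\ge1$, and let $n_1,\dots,n_k$ be arbitrary integers (of any signs). Then $$M\big(\mathcal{G}(m,n_1)\,\mathcal{G}(m,n_2)\cdots\mathcal{G}(m,n_k)\big)=M\big(\mathcal{G}(m,n_1+n_2+\dots+n_k)\big),$$ where juxtaposition denotes adjunction of signed graphs of width $m$, as defined in the context.
   Context: A signed graph is a graph whose edges are each labeled $+1$ or $-1$. For a signed graph $\mathcal{G}$, $M(\mathcal{G})$ is the sum, over all perfect matchings of $\mathcal{G}$, of the product of the signs of the edges in the matching. A signed graph of width $m$ is a subgraph of an $m$-by-$n$ grid graph, for some $n$, whose vertices are arranged in $m$ rows, with each edge signed $\pm1$. For signed graphs $\mathcal{G}_1,\mathcal{G}_2$ of width $m$, the adjoined graph $\mathcal{G}_1\mathcal{G}_2$ is formed by placing $\mathcal{G}_1$ to the left of $\mathcal{G}_2$. For each row $i=1,\dots,m$, the rightmost vertex of $\mathcal{G}_1$ in row $i$ is then joined to the leftmost vertex of $\mathcal{G}_2$ in row $i$ by a new edge of sign $+1$. Adjunction is associative. For $n\ge1$, $\mathcal{G}(m,n)$ is the $m$-by-$n$ grid graph ($m$ rows of $n$ vertices, edges joining horizontal and vertical neighbors), with all edges of sign $+1$. For $n\le0$, $\mathcal{G}(m,n)$ is obtained from the $m$-by-$(2-n)$ grid graph as follows: delete the vertical edges in the leftmost column and in the rightmost column; give all horizontal edges sign $+1$; give all remaining vertical edges sign $-1$. -}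

module Defs where

open import Data.Bool using (Bool; true; false; if_then_else_; _∧_)
open import Data.Nat using (ℕ; zero; suc; _+_; _∸_; _≡ᵇ_)
open import Data.Integer as ℤ using (ℤ; +_; -[1+_])
open import Data.List using (List; []; _∷_; _++_; map; concatMap; upTo; foldr)
open import Data.Nat.ListAction using (sum)
open import Data.Bool.ListAction using (all)
open import Data.List.NonEmpty using (List⁺; foldl₁) renaming (map to map⁺)
open import Data.Product using (_×_; _,_)
open import Data.Sign using (Sign) renaming (+ to pos; - to neg)

-- A signed graph of width m is represented on the full
-- m-by-(suc lastCol) grid vertex set: vertices are pairs (r , c) with
-- r < m (row) and c ≤ lastCol (column), numbered from 0.  Edges form a
-- list; an edge joins (r1,c1) and (r2,c2) and carries a sign ±1.
-- (Every graph built below uses only horizontal/vertical grid edges.)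

record Edge : Set where
  constructor edge
  field
    r1 c1 r2 c2 : ℕ
    sgn : Sign

open Edge public

record SGraph (m : ℕ) : Set where
  constructor mkG
  field
    lastCol : ℕ          -- the grid has columns 0 .. lastCol
    edges   : List Edge

open SGraph public

vertices : ∀ {m} → SGraph m → List (ℕ × ℕ)
vertices {m} G =
  concatMap (λ r → map (λ c → r , c) (upTo (suc (lastCol G)))) (upTo m)

subsets : {A : Set} → List A → List (List A)
subsets []       = [] ∷ []
subsets (x ∷ xs) = subsets xs ++ map (x ∷_) (subsets xs)

incident : ℕ × ℕ → Edge → Bool
incident (r , c) e =
  if (r ≡ᵇ r1 e) ∧ (c ≡ᵇ c1 e) then true else ((r ≡ᵇ r2 e) ∧ (c ≡ᵇ c2 e))

degree : List Edge → ℕ × ℕ → ℕ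
degree S v = sum (map (λ e → if incident v e then 1 else 0) S)

isPerfectMatching : ∀ {m} → SGraph m → List Edge → Bool
isPerfectMatching G S = all (λ v → degree S v ≡ᵇ 1) (vertices G)

signℤ : Sign → ℤ
signℤ pos = + 1
signℤ neg = ℤ.- (+ 1)

signProduct : List Edge → ℤ
signProduct S = foldr (λ e z → signℤ (sgn e) ℤ.* z) (+ 1) S

M : ∀ {m} → SGraph m → ℤ
M G = foldr ℤ._+_ (+ 0)
  (map (λ S → if isPerfectMatching G S then signProduct S else + 0)
       (subsets (edges G)))

shiftEdge : ℕ → Edge → Edge
shiftEdge k (edge a b c d s) = edge a (k + b) c (k + d) s

adjoin : ∀ {m} → SGraph m → SGraph m → SGraph m
adjoin {m} (mkG l₁ E₁) (mkG l₂ E₂) =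
  mkG (suc l₁ + l₂)
      (E₁ ++ map (λ i → edge i l₁ i (suc l₁) pos) (upTo m)
          ++ map (shiftEdge (suc l₁)) E₂)

-- index of the last column: n columns if n ≥ 1, 2 - n columns if n ≤ 0
lastColOf : ℤ → ℕ
lastColOf (+ zero)    = 1
lastColOf (+ (suc k)) = k
lastColOf (-[1+ k ])  = suc (suc k)

horizontalEdges : ℕ → ℕ → List Edge
horizontalEdges m l =
  concatMap (λ i → map (λ j → edge i j i (suc j) pos) (upTo l)) (upTo m)

-- n ≤ 0: the m-by-(l+1) grid (l+1 = 2-n), vertical edges of the leftmost
-- and rightmost columns deleted, horizontal edges +1, other vertical -1
nonposGraph : (m l : ℕ) → SGraph m
nonposGraph m l = mkG l
  (horizontalEdges m l ++
   concatMap (λ i → map (λ j → edge i (suc j) (suc i) (suc j) neg)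
                        (upTo (l ∸ 1)))
             (upTo (m ∸ 1)))

Gr : (m : ℕ) → ℤ → SGraph m
Gr m (+ (suc k)) = mkG k
  (horizontalEdges m k ++
   concatMap (λ i → map (λ j → edge i j (suc i) j pos) (upTo (suc k)))
             (upTo (m ∸ 1)))


Gr m n@(+ zero)   = nonposGraph m (lastColOf n)
Gr m n@(-[1+ k ]) = nonposGraph m (lastColOf n)

adjoinAll : (m : ℕ) → List⁺ ℤ → SGraph m
adjoinAll m ns = foldl₁ adjoin (map⁺ (Gr m) ns)

sum⁺ : List⁺ ℤ → ℤ
sum⁺ = foldl₁ ℤ._+_

module Submission where

-- A boundary state x ∈ 𝔹^m records which rows of a graph of width m have their leftmost
-- (or rightmost) vertex matched from outside; the transfer matrix of G counts, with signs,
-- the matchings of G compatible with given left and right states.  Then M G is the (0,0)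
-- entry, and adjunction multiplies transfer matrices.  Let P, Q and N be the transfer
-- matrices of one column carrying all positive rungs, all negative rungs, and no edges.
-- Then G(m,n) has matrix P^n for n ≥ 1 and N Q^(-n) N for n ≤ 0, and N N = 1.  The sum
-- over the middle state in P N Q (or Q N P) overlays the two columns into a single one in
-- which every rung occurs twice with opposite signs; these cancel, so P N Q = Q N P = N.
-- Hence P is invertible with inverse N Q N, G(m,n) has matrix P^n for every integer n,
-- and the theorem is P^(n₁) ⋯ P^(n_k) = P^(n₁ + ⋯ + n_k).

open import Algebra.Bundles using (Monoid)
open import Data.Bool using (Bool; true; false; if_then_else_; _∧_; _∨_; not; T)
open import Data.Bool.ListAction using (all; and)
import Data.Bool.Properties as Boolₚ
open import Data.Empty using (⊥-elim)
open import Data.Integer as ℤ using (ℤ; +_; -[1+_]; _+_; _*_)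
import Data.Integer.Properties as ℤₚ
open import Data.List using (List; []; _∷_; _++_; map; foldr; foldl; upTo; concatMap)
open import Data.List.NonEmpty as List⁺ using (List⁺)
import Data.List.Properties as Listₚ
open import Data.List.Relation.Binary.Permutation.Propositional as ↭ using (_↭_; prep; swap)
import Data.List.Relation.Binary.Permutation.Propositional.Properties as ↭ₚ
open import Data.List.Relation.Unary.All as All using (All; []; _∷_)
import Data.List.Relation.Unary.All.Properties as Allₚ
open import Data.Nat as ℕ using (ℕ; zero; suc; _≤_; _<_; s≤s; _≡ᵇ_; _∸_)
open import Data.Nat.ListAction using (sum)
import Data.Nat.ListAction.Properties as ℕLₚ
import Data.Nat.Properties as ℕₚ
import Data.Nat.Tactic.RingSolver as ℕSolver
open import Data.Product using (_×_; _,_; proj₁; proj₂; Σ-syntax)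
open import Data.Sign using (Sign) renaming (+ to pos; - to neg)
open import Data.Sum using (_⊎_; inj₁; inj₂)
open import Data.Vec as Vec using (Vec; []; _∷_; replicate)
open import Function using (_∘_; id; case_of_)
open import Function.Bundles using (Equivalence)
open import Level using (0ℓ)
open import Relation.Nullary using (yes; no)
open import Defs

module Powers {c ℓ} (𝕄 : Monoid c ℓ) where

  open Monoid 𝕄
  open import Algebra.Properties.Monoid.Mult 𝕄 using (×-homo-+; ×-homo-1) renaming (_×_ to _times_)
  open import Relation.Binary.Reasoning.Setoid setoid
  open import Relation.Binary.PropositionalEquality using (cong)

  infixr 8 _^_
  _^_ : Carrier → ℕ → Carrier
  x ^ n = n times x

  ^-sucʳ : ∀ x n → x ^ n ∙ x ≈ x ^ suc n
  ^-sucʳ x n = begin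
    x ^ n ∙ x         ≈⟨ ∙-congˡ (×-homo-1 x) ⟨
    x ^ n ∙ x ^ 1     ≈⟨ ×-homo-+ x n 1 ⟨
    x ^ (n ℕ.+ 1)     ≡⟨ cong (x ^_) (ℕₚ.+-comm n 1) ⟩
    x ^ suc n         ∎

  ^-conjugate : ∀ {u} → u ∙ u ≈ ε → ∀ x n → u ∙ x ^ n ∙ u ≈ (u ∙ x ∙ u) ^ n
  ^-conjugate {u} uu≈ε x zero = begin
    u ∙ ε ∙ u   ≈⟨ ∙-congʳ (identityʳ u) ⟩
    u ∙ u       ≈⟨ uu≈ε ⟩
    ε           ∎
  ^-conjugate {u} uu≈ε x (suc n) = begin
    u ∙ (x ∙ x ^ n) ∙ u         ≈⟨ assoc u (x ∙ x ^ n) u ⟩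
    u ∙ (x ∙ x ^ n ∙ u)         ≈⟨ ∙-congˡ (assoc x (x ^ n) u) ⟩
    u ∙ (x ∙ (x ^ n ∙ u))       ≈⟨ assoc u x (x ^ n ∙ u) ⟨
    u ∙ x ∙ (x ^ n ∙ u)         ≈⟨ ∙-congˡ (identityˡ (x ^ n ∙ u)) ⟨
    u ∙ x ∙ (ε ∙ (x ^ n ∙ u))   ≈⟨ ∙-congˡ (∙-congʳ uu≈ε) ⟨
    u ∙ x ∙ (u ∙ u ∙ (x ^ n ∙ u)) ≈⟨ ∙-congˡ (assoc u u (x ^ n ∙ u)) ⟩
    u ∙ x ∙ (u ∙ (u ∙ (x ^ n ∙ u))) ≈⟨ assoc (u ∙ x) u (u ∙ (x ^ n ∙ u)) ⟨
    u ∙ x ∙ u ∙ (u ∙ (x ^ n ∙ u))   ≈⟨ ∙-congˡ (assoc u (x ^ n) u) ⟨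
    u ∙ x ∙ u ∙ (u ∙ x ^ n ∙ u)     ≈⟨ ∙-congˡ (^-conjugate uu≈ε x n) ⟩
    (u ∙ x ∙ u) ∙ (u ∙ x ∙ u) ^ n   ∎

  module Invertible {a a⁻¹ : Carrier} (inverseˡ : a⁻¹ ∙ a ≈ ε) (inverseʳ : a ∙ a⁻¹ ≈ ε) where

    infixr 8 a^_
    a^_ : ℤ → Carrier
    a^ (+ n)     = a ^ n
    a^ -[1+ n ]  = a⁻¹ ^ suc n

    cancelˡ : ∀ {b c} → b ∙ c ≈ ε → ∀ y → b ∙ (c ∙ y) ≈ y
    cancelˡ {b} {c} bc≈ε y = begin
      b ∙ (c ∙ y)   ≈⟨ assoc b c y ⟨
      b ∙ c ∙ y     ≈⟨ ∙-congʳ bc≈ε ⟩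
      ε ∙ y         ≈⟨ identityˡ y ⟩
      y             ∎

    a^-suc : ∀ j → a^ (ℤ.suc j) ≈ a ∙ a^ j
    a^-suc (+ n)            = refl
    a^-suc -[1+ zero ]      = sym (trans (∙-congˡ (identityʳ a⁻¹)) inverseʳ)
    a^-suc -[1+ suc n ]     = sym (cancelˡ inverseʳ (a⁻¹ ^ suc n))

    a^-pred : ∀ j → a^ (ℤ.pred j) ≈ a⁻¹ ∙ a^ j
    a^-pred (+ zero)    = refl
    a^-pred (+ suc n)   = sym (cancelˡ inverseˡ (a ^ n))
    a^-pred -[1+ n ]    = refl

    a^-homo : ∀ i j → a^ (i ℤ.+ j) ≈ a^ i ∙ a^ j
    a^-homo (+ zero) j = begin
      a^ (+ 0 ℤ.+ j)   ≡⟨ cong a^_ (ℤₚ.+-identityˡ j) ⟩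
      a^ j             ≈⟨ identityˡ (a^ j) ⟨
      ε ∙ a^ j         ∎
    a^-homo (+ suc n) j = begin
      a^ (+ suc n ℤ.+ j)         ≡⟨ cong a^_ (ℤₚ.+-assoc (+ 1) (+ n) j) ⟩
      a^ (+ 1 ℤ.+ (+ n ℤ.+ j))   ≈⟨ a^-suc (+ n ℤ.+ j) ⟩
      a ∙ a^ (+ n ℤ.+ j)         ≈⟨ ∙-congˡ (a^-homo (+ n) j) ⟩
      a ∙ (a ^ n ∙ a^ j)         ≈⟨ assoc a (a ^ n) (a^ j) ⟨
      a ^ suc n ∙ a^ j           ∎
    a^-homo -[1+ zero ] j = begin
      a^ (-[1+ 0 ] ℤ.+ j)        ≈⟨ a^-pred j ⟩
      a⁻¹ ∙ a^ j                 ≈⟨ ∙-congʳ (identityʳ a⁻¹) ⟨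
      a⁻¹ ∙ ε ∙ a^ j             ∎
    a^-homo -[1+ suc n ] j = begin
      a^ (-[1+ suc n ] ℤ.+ j)             ≡⟨ cong a^_ (ℤₚ.+-assoc -[1+ 0 ] -[1+ n ] j) ⟩
      a^ (-[1+ 0 ] ℤ.+ (-[1+ n ] ℤ.+ j))  ≈⟨ a^-pred (-[1+ n ] ℤ.+ j) ⟩
      a⁻¹ ∙ a^ (-[1+ n ] ℤ.+ j)           ≈⟨ ∙-congˡ (a^-homo -[1+ n ] j) ⟩
      a⁻¹ ∙ (a⁻¹ ^ suc n ∙ a^ j)          ≈⟨ assoc a⁻¹ (a⁻¹ ^ suc n) (a^ j) ⟨
      a⁻¹ ^ suc (suc n) ∙ a^ j            ∎

open import Relation.Binary.PropositionalEquality
open ≡-Reasoning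

import Algebra.Properties.CommutativeSemigroup as CommutativeSemigroupProperties
module ℕ+ = CommutativeSemigroupProperties ℕₚ.+-commutativeSemigroup
module ℤ+ = CommutativeSemigroupProperties ℤₚ.+-commutativeSemigroup
module ℤ* = CommutativeSemigroupProperties ℤₚ.*-commutativeSemigroup

private
  variable
    A B : Set

∑ : List A → (A → ℤ) → ℤ
∑ L f = foldr _+_ (+ 0) (map f L)

∑-syntax : List A → (A → ℤ) → ℤ
∑-syntax = ∑

infix 5 ∑-syntax
syntax ∑-syntax L (λ x → e) = ∑[ x ∈ L ] e

∑-cong : (L : List A) {f g : A → ℤ} → (∀ x → f x ≡ g x) → ∑ L f ≡ ∑ L g
∑-cong []      eq = refl
∑-cong (x ∷ L) eq = cong₂ _+_ (eq x) (∑-cong L eq)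

∑-++ : (L K : List A) (f : A → ℤ) → ∑ (L ++ K) f ≡ ∑ L f + ∑ K f
∑-++ []      K f = sym (ℤₚ.+-identityˡ _)
∑-++ (x ∷ L) K f = trans (cong (_+_ (f x)) (∑-++ L K f)) (sym (ℤₚ.+-assoc (f x) _ _))

∑-map : (g : A → B) (L : List A) (f : B → ℤ) → ∑ (map g L) f ≡ ∑ L (f ∘ g)
∑-map g []      f = refl
∑-map g (x ∷ L) f = cong (_+_ (f (g x))) (∑-map g L f)

∑-zero : (L : List A) → ∑[ x ∈ L ] + 0 ≡ + 0
∑-zero []      = refl
∑-zero (x ∷ L) = trans (ℤₚ.+-identityˡ _) (∑-zero L)

∑-+ : (L : List A) (f g : A → ℤ) → ∑[ x ∈ L ] (f x + g x) ≡ ∑ L f + ∑ L g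
∑-+ []      f g = refl
∑-+ (x ∷ L) f g = trans (cong (_+_ (f x + g x)) (∑-+ L f g)) (ℤ+.interchange (f x) (g x) (∑ L f) (∑ L g))

∑-*ˡ : (L : List A) (c : ℤ) (f : A → ℤ) → ∑[ x ∈ L ] (c * f x) ≡ c * ∑ L f
∑-*ˡ []      c f = sym (ℤₚ.*-zeroʳ c)
∑-*ˡ (x ∷ L) c f = trans (cong (_+_ (c * f x)) (∑-*ˡ L c f)) (sym (ℤₚ.*-distribˡ-+ c (f x) _))

∑-*ʳ : (L : List A) (c : ℤ) (f : A → ℤ) → ∑[ x ∈ L ] (f x * c) ≡ ∑ L f * c
∑-*ʳ []      c f = sym (ℤₚ.*-zeroˡ c)
∑-*ʳ (x ∷ L) c f = trans (cong (_+_ (f x * c)) (∑-*ʳ L c f)) (sym (ℤₚ.*-distribʳ-+ c (f x) _))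

∑-comm : (L : List A) (K : List B) (f : A → B → ℤ) →
  ∑[ x ∈ L ] ∑[ y ∈ K ] f x y ≡ ∑[ y ∈ K ] ∑[ x ∈ L ] f x y
∑-comm []      K f = sym (∑-zero K)
∑-comm (x ∷ L) K f =
  trans (cong (_+_ (∑ K (f x))) (∑-comm L K f)) (sym (∑-+ K (f x) (λ y → ∑[ x ∈ L ] f x y)))

∑⊆ : List A → (List A → ℤ) → ℤ
∑⊆ E = ∑ (subsets E)

infix 5 ∑⊆
syntax ∑⊆ E (λ S → e) = ∑[ S ⊆ E ] e

subsets-map : (g : A → B) (L : List A) → subsets (map g L) ≡ map (map g) (subsets L)
subsets-map g []      = refl
subsets-map g (x ∷ L) rewrite subsets-map g L = begin
  map (map g) (subsets L) ++ map (g x ∷_) (map (map g) (subsets L))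
    ≡⟨ cong (map (map g) (subsets L) ++_) (trans (sym (Listₚ.map-∘ (subsets L))) (Listₚ.map-∘ (subsets L))) ⟩
  map (map g) (subsets L) ++ map (map g) (map (x ∷_) (subsets L))
    ≡⟨ Listₚ.map-++ (map g) (subsets L) _ ⟨
  map (map g) (subsets L ++ map (x ∷_) (subsets L)) ∎

∑⊆-∷ : (x : A) (E : List A) (f : List A → ℤ) → ∑⊆ (x ∷ E) f ≡ ∑⊆ E f + (∑[ S ⊆ E ] f (x ∷ S))
∑⊆-∷ x E f = trans (∑-++ (subsets E) _ f) (cong (_+_ (∑⊆ E f)) (∑-map (x ∷_) (subsets E) f))

∑⊆-map : (g : A → B) (E : List A) (f : List B → ℤ) → ∑⊆ (map g E) f ≡ ∑[ S ⊆ E ] f (map g S)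
∑⊆-map g E f = trans (cong (λ L → ∑ L f) (subsets-map g E)) (∑-map (map g) (subsets E) f)

∑⊆-++ : (E F : List A) (f : List A → ℤ) → ∑⊆ (E ++ F) f ≡ ∑[ S ⊆ E ] ∑[ T ⊆ F ] f (S ++ T)
∑⊆-++ []      F f = sym (ℤₚ.+-identityʳ _)
∑⊆-++ (x ∷ E) F f = begin
  ∑⊆ (x ∷ E ++ F) f
    ≡⟨ ∑⊆-∷ x (E ++ F) f ⟩
  ∑⊆ (E ++ F) f + ∑⊆ (E ++ F) (f ∘ (x ∷_))
    ≡⟨ cong₂ _+_ (∑⊆-++ E F f) (∑⊆-++ E F (f ∘ (x ∷_))) ⟩
  (∑[ S ⊆ E ] ∑[ T ⊆ F ] f (S ++ T)) + (∑[ S ⊆ E ] ∑[ T ⊆ F ] f (x ∷ S ++ T))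
    ≡⟨ ∑⊆-∷ x E (λ S → ∑[ T ⊆ F ] f (S ++ T)) ⟨
  ∑[ S ⊆ x ∷ E ] ∑[ T ⊆ F ] f (S ++ T) ∎

∑⊆-cong-All : {P : A → Set} {E : List A} {f g : List A → ℤ} →
  All P E → (∀ S → All P S → f S ≡ g S) → ∑⊆ E f ≡ ∑⊆ E g
∑⊆-cong-All {E = []}    []         eq = cong (_+ + 0) (eq [] [])
∑⊆-cong-All {E = x ∷ E} (px ∷ pE) eq =
  trans (∑⊆-∷ x E _)
    (trans (cong₂ _+_ (∑⊆-cong-All pE eq) (∑⊆-cong-All pE (λ S pS → eq (x ∷ S) (px ∷ pS))))
      (sym (∑⊆-∷ x E _)))

∑⊆-↭ : {E E' : List A} (f : List A → ℤ) → (∀ {S S'} → S ↭ S' → f S ≡ f S') →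
  E ↭ E' → ∑⊆ E f ≡ ∑⊆ E' f
∑⊆-↭ f inv ↭.refl = refl
∑⊆-↭ {E = x ∷ E} {x ∷ E'} f inv (prep x p) = begin
  ∑⊆ (x ∷ E) f
    ≡⟨ ∑⊆-∷ x E f ⟩
  ∑⊆ E f + ∑⊆ E (f ∘ (x ∷_))
    ≡⟨ cong₂ _+_ (∑⊆-↭ f inv p) (∑⊆-↭ (f ∘ (x ∷_)) (inv ∘ prep x) p) ⟩
  ∑⊆ E' f + ∑⊆ E' (f ∘ (x ∷_))
    ≡⟨ ∑⊆-∷ x E' f ⟨
  ∑⊆ (x ∷ E') f ∎
∑⊆-↭ {E = x ∷ y ∷ E} {y ∷ x ∷ E'} f inv (swap x y p) = begin
  ∑⊆ (x ∷ y ∷ E) f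
    ≡⟨ expand x y E ⟩
  ∑⊆ E f + ∑⊆ E (f ∘ (y ∷_)) + (∑⊆ E (f ∘ (x ∷_)) + ∑⊆ E (f ∘ (x ∷_) ∘ (y ∷_)))
    ≡⟨ cong₂ _+_ (cong₂ _+_ (∑⊆-↭ f inv p) (∑⊆-↭ _ (inv ∘ prep y) p))
                 (cong₂ _+_ (∑⊆-↭ _ (inv ∘ prep x) p)
                            (trans (∑-cong (subsets E) (λ _ → inv (swap x y ↭.refl)))
                                   (∑⊆-↭ _ (inv ∘ prep y ∘ prep x) p))) ⟩
  a + c + (b + d)
    ≡⟨ ℤ+.interchange a c b d ⟩
  a + b + (c + d)
    ≡⟨ expand y x E' ⟨
  ∑⊆ (y ∷ x ∷ E') f ∎
  where
  a = ∑⊆ E' f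
  b = ∑⊆ E' (f ∘ (x ∷_))
  c = ∑⊆ E' (f ∘ (y ∷_))
  d = ∑⊆ E' (f ∘ (y ∷_) ∘ (x ∷_))
  expand : ∀ u v F → ∑⊆ (u ∷ v ∷ F) f ≡
    ∑⊆ F f + ∑⊆ F (f ∘ (v ∷_)) + (∑⊆ F (f ∘ (u ∷_)) + ∑⊆ F (f ∘ (u ∷_) ∘ (v ∷_)))
  expand u v F = trans (∑⊆-∷ u (v ∷ F) f) (cong₂ _+_ (∑⊆-∷ v F f) (∑⊆-∷ v F (f ∘ (u ∷_))))
∑⊆-↭ f inv (↭.trans p q) = trans (∑⊆-↭ f inv p) (∑⊆-↭ f inv q)

∑𝔹 : (m : ℕ) → (Vec Bool m → ℤ) → ℤ
∑𝔹 zero    f = f []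
∑𝔹 (suc m) f = ∑𝔹 m (f ∘ (false ∷_)) + ∑𝔹 m (f ∘ (true ∷_))

infix 5 ∑𝔹
syntax ∑𝔹 m (λ v → e) = ∑[ v ∈𝔹^ m ] e

∑𝔹-cong : (m : ℕ) {f g : Vec Bool m → ℤ} → (∀ v → f v ≡ g v) → ∑𝔹 m f ≡ ∑𝔹 m g
∑𝔹-cong zero    eq = eq []
∑𝔹-cong (suc m) eq = cong₂ _+_ (∑𝔹-cong m (eq ∘ (false ∷_))) (∑𝔹-cong m (eq ∘ (true ∷_)))

∑𝔹-zero : (m : ℕ) → ∑[ v ∈𝔹^ m ] + 0 ≡ + 0
∑𝔹-zero zero    = refl
∑𝔹-zero (suc m) = cong₂ _+_ (∑𝔹-zero m) (∑𝔹-zero m)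

∑𝔹-+ : (m : ℕ) (f g : Vec Bool m → ℤ) → ∑[ v ∈𝔹^ m ] (f v + g v) ≡ ∑𝔹 m f + ∑𝔹 m g
∑𝔹-+ zero    f g = refl
∑𝔹-+ (suc m) f g =
  trans (cong₂ _+_ (∑𝔹-+ m _ _) (∑𝔹-+ m _ _))
        (ℤ+.interchange (∑𝔹 m (f ∘ (false ∷_))) (∑𝔹 m (g ∘ (false ∷_))) (∑𝔹 m (f ∘ (true ∷_))) _)

∑𝔹-*ˡ : (m : ℕ) (c : ℤ) (f : Vec Bool m → ℤ) → ∑[ v ∈𝔹^ m ] (c * f v) ≡ c * ∑𝔹 m f
∑𝔹-*ˡ zero    c f = refl
∑𝔹-*ˡ (suc m) c f =
  trans (cong₂ _+_ (∑𝔹-*ˡ m c (f ∘ (false ∷_))) (∑𝔹-*ˡ m c (f ∘ (true ∷_))))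
        (sym (ℤₚ.*-distribˡ-+ c (∑𝔹 m (f ∘ (false ∷_))) _))

∑𝔹-*ʳ : (m : ℕ) (c : ℤ) (f : Vec Bool m → ℤ) → ∑[ v ∈𝔹^ m ] (f v * c) ≡ ∑𝔹 m f * c
∑𝔹-*ʳ zero    c f = refl
∑𝔹-*ʳ (suc m) c f =
  trans (cong₂ _+_ (∑𝔹-*ʳ m c (f ∘ (false ∷_))) (∑𝔹-*ʳ m c (f ∘ (true ∷_))))
        (sym (ℤₚ.*-distribʳ-+ c (∑𝔹 m (f ∘ (false ∷_))) _))

∑-∑𝔹-comm : (L : List A) (m : ℕ) (f : A → Vec Bool m → ℤ) →
  ∑[ x ∈ L ] ∑[ v ∈𝔹^ m ] f x v ≡ ∑[ v ∈𝔹^ m ] ∑[ x ∈ L ] f x v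
∑-∑𝔹-comm []      m f = sym (∑𝔹-zero m)
∑-∑𝔹-comm (x ∷ L) m f =
  trans (cong (_+_ (∑𝔹 m (f x))) (∑-∑𝔹-comm L m f)) (sym (∑𝔹-+ m (f x) _))

∑𝔹-comm : (m n : ℕ) (f : Vec Bool m → Vec Bool n → ℤ) →
  ∑[ u ∈𝔹^ m ] ∑[ v ∈𝔹^ n ] f u v ≡ ∑[ v ∈𝔹^ n ] ∑[ u ∈𝔹^ m ] f u v
∑𝔹-comm zero    n f = refl
∑𝔹-comm (suc m) n f =
  trans (cong₂ _+_ (∑𝔹-comm m n _) (∑𝔹-comm m n _)) (sym (∑𝔹-+ n _ _))

support : ∀ {m} → Vec Bool m → List ℕ
support []          = []
support (false ∷ v) = map suc (support v)
support (true ∷ v)  = 0 ∷ map suc (support v)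

∑⊆-upTo : (m : ℕ) (f : List ℕ → ℤ) → ∑⊆ (upTo m) f ≡ ∑[ v ∈𝔹^ m ] f (support v)
∑⊆-upTo zero    f = ℤₚ.+-identityʳ _
∑⊆-upTo (suc m) f = begin
  ∑⊆ (upTo (suc m)) f
    ≡⟨ cong (λ L → ∑⊆ (0 ∷ L) f) (sym (Listₚ.map-upTo suc m)) ⟩
  ∑⊆ (0 ∷ map suc (upTo m)) f
    ≡⟨ ∑⊆-∷ 0 (map suc (upTo m)) f ⟩
  ∑⊆ (map suc (upTo m)) f + ∑⊆ (map suc (upTo m)) (f ∘ (0 ∷_))
    ≡⟨ cong₂ _+_ (trans (∑⊆-map suc (upTo m) f) (∑⊆-upTo m _))
                 (trans (∑⊆-map suc (upTo m) _) (∑⊆-upTo m _)) ⟩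
  ∑𝔹 (suc m) (f ∘ support) ∎

Mat : ℕ → Set
Mat m = Vec Bool m → Vec Bool m → ℤ

module _ {m : ℕ} where

  infixl 7 _⊙_
  _⊙_ : Mat m → Mat m → Mat m
  (A ⊙ B) x z = ∑[ v ∈𝔹^ m ] A x v * B v z

  infix 4 _≈ᴹ_
  _≈ᴹ_ : Mat m → Mat m → Set
  A ≈ᴹ B = ∀ x z → A x z ≡ B x z

  ⊙-assoc : (A B C : Mat m) → (A ⊙ B) ⊙ C ≈ᴹ A ⊙ (B ⊙ C)
  ⊙-assoc A B C x w = begin
    ∑[ u ∈𝔹^ m ] (∑[ v ∈𝔹^ m ] A x v * B v u) * C u w
      ≡⟨ ∑𝔹-cong m (λ u → ∑𝔹-*ʳ m (C u w) (λ v → A x v * B v u)) ⟨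
    ∑[ u ∈𝔹^ m ] ∑[ v ∈𝔹^ m ] A x v * B v u * C u w
      ≡⟨ ∑𝔹-comm m m _ ⟩
    ∑[ v ∈𝔹^ m ] ∑[ u ∈𝔹^ m ] A x v * B v u * C u w
      ≡⟨ ∑𝔹-cong m (λ v → trans (∑𝔹-cong m (λ u → ℤₚ.*-assoc (A x v) (B v u) (C u w)))
                                 (∑𝔹-*ˡ m (A x v) (λ u → B v u * C u w))) ⟩
    ∑[ v ∈𝔹^ m ] A x v * (∑[ u ∈𝔹^ m ] B v u * C u w) ∎

δ : ∀ {m} → Mat m
δ []          []          = + 1
δ (false ∷ x) (false ∷ y) = δ x y
δ (true ∷ x)  (true ∷ y)  = δ x y
δ (false ∷ x) (true ∷ y)  = + 0
δ (true ∷ x)  (false ∷ y) = + 0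

∑𝔹-δˡ : ∀ {m} (x : Vec Bool m) (f : Vec Bool m → ℤ) → ∑[ v ∈𝔹^ m ] δ x v * f v ≡ f x
∑𝔹-δˡ          []          f = ℤₚ.*-identityˡ (f [])
∑𝔹-δˡ {suc m} (false ∷ x) f =
  trans (cong₂ _+_ (∑𝔹-δˡ x (f ∘ (false ∷_))) (∑𝔹-zero m)) (ℤₚ.+-identityʳ _)
∑𝔹-δˡ {suc m} (true ∷ x)  f =
  trans (cong (_+ ∑𝔹 m (λ v → δ x v * f (true ∷ v))) (∑𝔹-zero m))
        (trans (ℤₚ.+-identityˡ _) (∑𝔹-δˡ x (f ∘ (true ∷_))))

∑𝔹-δʳ : ∀ {m} (z : Vec Bool m) (f : Vec Bool m → ℤ) → ∑[ v ∈𝔹^ m ] f v * δ v z ≡ f z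
∑𝔹-δʳ {m} z f = trans (∑𝔹-cong m (λ v → trans (ℤₚ.*-comm (f v) (δ v z)) (cong (_* f v) (δ-sym v z))))
                      (∑𝔹-δˡ z f)
  where
  δ-sym : ∀ {m} (x y : Vec Bool m) → δ x y ≡ δ y x
  δ-sym []          []          = refl
  δ-sym (false ∷ x) (false ∷ y) = δ-sym x y
  δ-sym (true ∷ x)  (true ∷ y)  = δ-sym x y
  δ-sym (false ∷ x) (true ∷ y)  = refl
  δ-sym (true ∷ x)  (false ∷ y) = refl

module _ {m : ℕ} where

  ≈ᴹ-refl : {A : Mat m} → A ≈ᴹ A
  ≈ᴹ-refl x z = refl

  ≈ᴹ-sym : {A B : Mat m} → A ≈ᴹ B → B ≈ᴹ A
  ≈ᴹ-sym A≈B x z = sym (A≈B x z)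

  ≈ᴹ-trans : {A B C : Mat m} → A ≈ᴹ B → B ≈ᴹ C → A ≈ᴹ C
  ≈ᴹ-trans A≈B B≈C x z = trans (A≈B x z) (B≈C x z)

  ⊙-cong : {A A' B B' : Mat m} → A ≈ᴹ A' → B ≈ᴹ B' → A ⊙ B ≈ᴹ A' ⊙ B'
  ⊙-cong A≈A' B≈B' x z = ∑𝔹-cong m (λ v → cong₂ _*_ (A≈A' x v) (B≈B' v z))

  ⊙-congˡ : (A : Mat m) {B B' : Mat m} → B ≈ᴹ B' → A ⊙ B ≈ᴹ A ⊙ B'
  ⊙-congˡ A = ⊙-cong {A} {A} ≈ᴹ-refl

  ⊙-congʳ : (B : Mat m) {A A' : Mat m} → A ≈ᴹ A' → A ⊙ B ≈ᴹ A' ⊙ B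
  ⊙-congʳ B A≈A' = ⊙-cong {B = B} {B} A≈A' ≈ᴹ-refl

  ⊙-identityˡ : (A : Mat m) → δ ⊙ A ≈ᴹ A
  ⊙-identityˡ A x z = ∑𝔹-δˡ x (λ v → A v z)

  ⊙-identityʳ : (A : Mat m) → A ⊙ δ ≈ᴹ A
  ⊙-identityʳ A x z = ∑𝔹-δʳ z (A x)

matrixMonoid : ℕ → Monoid 0ℓ 0ℓ
matrixMonoid m = record
  { Carrier  = Mat m
  ; _≈_      = _≈ᴹ_
  ; _∙_      = _⊙_
  ; ε        = δ
  ; isMonoid = record
    { isSemigroup = record
      { isMagma = record
        { isEquivalence = record { refl = ≈ᴹ-refl ; sym = ≈ᴹ-sym ; trans = ≈ᴹ-trans }
        ; ∙-cong        = ⊙-cong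
        }
      ; assoc = ⊙-assoc
      }
    ; identity = ⊙-identityˡ , ⊙-identityʳ
    }
  }

bit : Bool → ℕ
bit b = if b then 1 else 0

⟦_⟧ : Bool → ℤ
⟦ b ⟧ = if b then + 1 else + 0

⟦∧⟧ : ∀ a b → ⟦ a ∧ b ⟧ ≡ ⟦ a ⟧ * ⟦ b ⟧
⟦∧⟧ true  b = sym (ℤₚ.*-identityˡ ⟦ b ⟧)
⟦∧⟧ false b = refl

if-as-⟦⟧ : ∀ b s → (if b then s else + 0) ≡ ⟦ b ⟧ * s
if-as-⟦⟧ true  s = sym (ℤₚ.*-identityˡ s)
if-as-⟦⟧ false s = refl

infixl 10 _!_
_!_ : ∀ {m} → Vec Bool m → ℕ → Bool
[]      ! r     = false
(b ∷ v) ! zero  = b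
(b ∷ v) ! suc r = v ! r

complement : ∀ {m} → Vec Bool m → Vec Bool m
complement = Vec.map not

complement-involutive : ∀ {m} (v : Vec Bool m) → complement (complement v) ≡ v
complement-involutive []      = refl
complement-involutive (b ∷ v) = cong₂ _∷_ (Boolₚ.not-involutive b) (complement-involutive v)

complement-! : ∀ {m} (v : Vec Bool m) {r} → r < m → complement v ! r ≡ not (v ! r)
complement-! (b ∷ v) {zero}  _         = refl
complement-! (b ∷ v) {suc r} (s≤s r<m) = complement-! v r<m

≢⇒≡ᵇ-false : ∀ {a b} → a ≢ b → (a ≡ᵇ b) ≡ false
≢⇒≡ᵇ-false {a} {b} a≢b with a ≡ᵇ b in eq
... | false = refl
... | true  = ⊥-elim (a≢b (ℕₚ.≡ᵇ⇒≡ a b (subst T (sym eq) _)))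

<⇒≡ᵇ-false : ∀ {a b} → a < b → (a ≡ᵇ b) ≡ false
<⇒≡ᵇ-false = ≢⇒≡ᵇ-false ∘ ℕₚ.<⇒≢

>⇒≡ᵇ-false : ∀ {a b} → b < a → (a ≡ᵇ b) ≡ false
>⇒≡ᵇ-false = ≢⇒≡ᵇ-false ∘ ℕₚ.>⇒≢

+-≡ᵇ-cancelˡ : ∀ k a b → (k ℕ.+ a ≡ᵇ k ℕ.+ b) ≡ (a ≡ᵇ b)
+-≡ᵇ-cancelˡ zero    a b = refl
+-≡ᵇ-cancelˡ (suc k) a b = +-≡ᵇ-cancelˡ k a b

+-≡ᵇ-self : ∀ k a → (k ℕ.+ a ≡ᵇ k) ≡ (a ≡ᵇ 0)
+-≡ᵇ-self zero    a = refl
+-≡ᵇ-self (suc k) a = +-≡ᵇ-self k a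

T-ext : ∀ {a b} → (T a → T b) → (T b → T a) → a ≡ b
T-ext {false} {false} f g = refl
T-ext {false} {true}  f g = ⊥-elim (g _)
T-ext {true}  {false} f g = ⊥-elim (f _)
T-ext {true}  {true}  f g = refl

sum-zeros : (L : List A) → sum (map (λ _ → 0) L) ≡ 0
sum-zeros []      = refl
sum-zeros (x ∷ L) = sum-zeros L

sum-map-suc : (I : List ℕ) {f : ℕ → ℕ} → sum (map f (map suc I)) ≡ sum (map (f ∘ suc) I)
sum-map-suc I = cong sum (sym (Listₚ.map-∘ I))

allBelow : ℕ → (ℕ → Bool) → Bool
allBelow zero    p = true
allBelow (suc m) p = p 0 ∧ allBelow m (p ∘ suc)

allBelow⁺ : ∀ m p → T (allBelow m p) → ∀ {r} → r < m → T (p r)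
allBelow⁺ (suc m) p h {zero}  _         = proj₁ (Equivalence.to Boolₚ.T-∧ h)
allBelow⁺ (suc m) p h {suc r} (s≤s r<m) = allBelow⁺ m (p ∘ suc) (proj₂ (Equivalence.to Boolₚ.T-∧ h)) r<m

allBelow⁻ : ∀ m p → (∀ {r} → r < m → T (p r)) → T (allBelow m p)
allBelow⁻ zero    p h = _
allBelow⁻ (suc m) p h = Equivalence.from Boolₚ.T-∧ (h (s≤s ℕ.z≤n) , allBelow⁻ m (p ∘ suc) (h ∘ s≤s))

allBelow-cong : ∀ m {p q} → (∀ {r} → r < m → p r ≡ q r) → allBelow m p ≡ allBelow m q
allBelow-cong zero    eq = refl
allBelow-cong (suc m) eq = cong₂ _∧_ (eq (s≤s ℕ.z≤n)) (allBelow-cong m (eq ∘ s≤s))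

allBelow-false : ∀ m p {r} → r < m → p r ≡ false → allBelow m p ≡ false
allBelow-false (suc m) p {zero}  _         eq rewrite eq = refl
allBelow-false (suc m) p {suc r} (s≤s r<m) eq
  rewrite allBelow-false m (p ∘ suc) r<m eq = Boolₚ.∧-zeroʳ (p 0)

∑𝔹-matchAcross : ∀ m (a b : ℕ → ℕ) →
  ∑[ Y ∈𝔹^ m ] ⟦ allBelow m (λ r → a r ℕ.+ bit (Y ! r) ≡ᵇ 1) ⟧ * ⟦ allBelow m (λ r → b r ℕ.+ bit (not (Y ! r)) ≡ᵇ 1) ⟧
  ≡ ⟦ allBelow m (λ r → a r ℕ.+ b r ≡ᵇ 1) ⟧
∑𝔹-matchAcross zero    a b = refl
∑𝔹-matchAcross (suc m) a b = begin
  ∑𝔹 m (F false) + ∑𝔹 m (F true)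
    ≡⟨ cong₂ _+_ (trans (∑𝔹-cong m (split false)) (∑𝔹-*ˡ m (row false) G))
                 (trans (∑𝔹-cong m (split true))  (∑𝔹-*ˡ m (row true) G)) ⟩
  row false * ∑𝔹 m G + row true * ∑𝔹 m G
    ≡⟨ ℤₚ.*-distribʳ-+ (∑𝔹 m G) (row false) (row true) ⟨
  (row false + row true) * ∑𝔹 m G
    ≡⟨ cong₂ _*_ (either-side (a 0) (b 0)) (∑𝔹-matchAcross m (a ∘ suc) (b ∘ suc)) ⟩
  ⟦ a 0 ℕ.+ b 0 ≡ᵇ 1 ⟧ * ⟦ allBelow m (λ r → a (suc r) ℕ.+ b (suc r) ≡ᵇ 1) ⟧
    ≡⟨ ⟦∧⟧ (a 0 ℕ.+ b 0 ≡ᵇ 1) _ ⟨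
  ⟦ allBelow (suc m) (λ r → a r ℕ.+ b r ≡ᵇ 1) ⟧ ∎
  where
  F : Bool → Vec Bool m → ℤ
  F c Y = ⟦ allBelow (suc m) (λ r → a r ℕ.+ bit ((c ∷ Y) ! r) ≡ᵇ 1) ⟧ *
          ⟦ allBelow (suc m) (λ r → b r ℕ.+ bit (not ((c ∷ Y) ! r)) ≡ᵇ 1) ⟧
  G : Vec Bool m → ℤ
  G Y = ⟦ allBelow m (λ r → a (suc r) ℕ.+ bit (Y ! r) ≡ᵇ 1) ⟧ *
        ⟦ allBelow m (λ r → b (suc r) ℕ.+ bit (not (Y ! r)) ≡ᵇ 1) ⟧
  row : Bool → ℤ
  row c = ⟦ a 0 ℕ.+ bit c ≡ᵇ 1 ⟧ * ⟦ b 0 ℕ.+ bit (not c) ≡ᵇ 1 ⟧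
  split : ∀ c Y → F c Y ≡ row c * G Y
  split c Y = trans (cong₂ _*_ (⟦∧⟧ (a 0 ℕ.+ bit c ≡ᵇ 1) _) (⟦∧⟧ (b 0 ℕ.+ bit (not c) ≡ᵇ 1) _))
                    (ℤ*.interchange ⟦ a 0 ℕ.+ bit c ≡ᵇ 1 ⟧ _ ⟦ b 0 ℕ.+ bit (not c) ≡ᵇ 1 ⟧ _)
  either-side : ∀ p q → ⟦ p ℕ.+ 0 ≡ᵇ 1 ⟧ * ⟦ q ℕ.+ 1 ≡ᵇ 1 ⟧ + ⟦ p ℕ.+ 1 ≡ᵇ 1 ⟧ * ⟦ q ℕ.+ 0 ≡ᵇ 1 ⟧
                        ≡ ⟦ p ℕ.+ q ≡ᵇ 1 ⟧
  either-side p q rewrite ℕₚ.+-identityʳ p | ℕₚ.+-identityʳ q | ℕₚ.+-comm p 1 | ℕₚ.+-comm q 1 = cases p q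
    where
    cases : ∀ p q → ⟦ p ≡ᵇ 1 ⟧ * ⟦ suc q ≡ᵇ 1 ⟧ + ⟦ suc p ≡ᵇ 1 ⟧ * ⟦ q ≡ᵇ 1 ⟧ ≡ ⟦ p ℕ.+ q ≡ᵇ 1 ⟧
    cases zero          zero          = refl
    cases zero          (suc zero)    = refl
    cases zero          (suc (suc q)) = refl
    cases (suc zero)    zero          = refl
    cases (suc zero)    (suc q)       = refl
    cases (suc (suc p)) zero          = refl
    cases (suc (suc p)) (suc q)       = refl

concatMap-++-↭ : (g h : A → List B) (L : List A) →
  concatMap (λ i → g i ++ h i) L ↭ concatMap g L ++ concatMap h L
concatMap-++-↭ g h []      = ↭.refl
concatMap-++-↭ g h (x ∷ L) =
  ↭.trans (↭ₚ.++⁺ˡ (g x ++ h x) (concatMap-++-↭ g h L))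
  (↭.trans (↭.↭-reflexive (Listₚ.++-assoc (g x) (h x) _))
  (↭.trans (↭ₚ.++⁺ˡ (g x) (↭ₚ.shifts (h x) (concatMap g L)))
           (↭.↭-reflexive (sym (Listₚ.++-assoc (g x) (concatMap g L) _)))))

interchange-↭ : (a b c d : List A) → (a ++ b) ++ (c ++ d) ↭ (a ++ c) ++ (b ++ d)
interchange-↭ a b c d =
  ↭.trans (↭.↭-reflexive (Listₚ.++-assoc a b (c ++ d)))
  (↭.trans (↭ₚ.++⁺ˡ a (↭ₚ.shifts b c)) (↭.↭-reflexive (sym (Listₚ.++-assoc a c (b ++ d)))))

concatMap-singleton : (f : A → B) (L : List A) → concatMap (λ i → f i ∷ []) L ≡ map f L
concatMap-singleton f L = trans (sym (Listₚ.concatMap-map (_∷ []) f L)) (Listₚ.concatMap-pure (map f L))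

concatMap-upTo-suc-↭ : (f : ℕ → ℕ → A) (n : ℕ) (L : List ℕ) →
  concatMap (λ i → map (f i) (upTo (suc n))) L ↭ concatMap (λ i → map (f i) (upTo n)) L ++ map (λ i → f i n) L
concatMap-upTo-suc-↭ f n L =
  ↭.trans (↭.↭-reflexive (Listₚ.concatMap-cong (λ i →
             trans (cong (map (f i)) (sym (Listₚ.upTo-∷ʳ n))) (Listₚ.map-++ (f i) (upTo n) (n ∷ []))) L))
  (↭.trans (concatMap-++-↭ _ _ L)
           (↭.↭-reflexive (cong (concatMap (λ i → map (f i) (upTo n)) L ++_) (concatMap-singleton (λ i → f i n) L))))

concatMap-[] : (L : List A) → concatMap {B = B} (λ _ → []) L ≡ []
concatMap-[] []      = refl
concatMap-[] (x ∷ L) = concatMap-[] L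

module _ {m : ℕ} where

  load : ℕ → Vec Bool m → Vec Bool m → List Edge → ℕ × ℕ → ℕ
  load L x y S (r , c) = degree S (r , c) ℕ.+ bit ((c ≡ᵇ 0) ∧ x ! r) ℕ.+ bit ((c ≡ᵇ L) ∧ y ! r)

  matches : SGraph m → Vec Bool m → Vec Bool m → List Edge → Bool
  matches G x y S = all (λ v → load (lastCol G) x y S v ≡ᵇ 1) (vertices G)

  weight : SGraph m → Vec Bool m → Vec Bool m → List Edge → ℤ
  weight G x y S = if matches G x y S then signProduct S else + 0

  transfer : SGraph m → Mat m
  transfer G x y = ∑[ S ⊆ edges G ] weight G x y S

  matches⁺ : ∀ G x y S → T (matches G x y S) →
    ∀ {r c} → r < m → c ≤ lastCol G → load (lastCol G) x y S (r , c) ≡ 1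
  matches⁺ G x y S h {r} {c} r<m c≤L =
    ℕₚ.≡ᵇ⇒≡ _ 1 (Allₚ.applyUpTo⁻ id (suc (lastCol G))
      (Allₚ.map⁻ (Allₚ.applyUpTo⁻ id m (Allₚ.map⁻ (Allₚ.concat⁻ (Allₚ.all⁺ _ (vertices G) h))) r<m))
      (s≤s c≤L))

  matches⁻ : ∀ G x y S → (∀ {r c} → r < m → c ≤ lastCol G → load (lastCol G) x y S (r , c) ≡ 1) →
    T (matches G x y S)
  matches⁻ G x y S h =
    Allₚ.all⁻ _ (Allₚ.concat⁺ (Allₚ.map⁺ (Allₚ.applyUpTo⁺₁ id m λ r<m →
      Allₚ.map⁺ (Allₚ.applyUpTo⁺₁ id (suc (lastCol G)) λ c<L →
        ℕₚ.≡⇒≡ᵇ _ 1 (h r<m (ℕₚ.≤-pred c<L))))))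

M-transfer : ∀ {m} (G : SGraph m) → M G ≡ transfer G (replicate m false) (replicate m false)
M-transfer {m} G = ∑-cong (subsets (edges G)) λ S →
  cong (λ b → if b then signProduct S else + 0)
       (cong and (Listₚ.map-cong (λ v → cong (_≡ᵇ 1) (noStubs S v)) (vertices G)))
  where
  replicate-! : ∀ n r → replicate n false ! r ≡ false
  replicate-! zero    r       = refl
  replicate-! (suc n) zero    = refl
  replicate-! (suc n) (suc r) = replicate-! n r
  noStubs : ∀ S v → degree S v ≡ load (lastCol G) (replicate m false) (replicate m false) S v
  noStubs S (r , c) rewrite replicate-! m r | Boolₚ.∧-zeroʳ (c ≡ᵇ 0) | Boolₚ.∧-zeroʳ (c ≡ᵇ lastCol G) =
    sym (trans (ℕₚ.+-identityʳ _) (ℕₚ.+-identityʳ _))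

degree-↭ : ∀ {S S'} v → S ↭ S' → degree S v ≡ degree S' v
degree-↭ v p = ℕLₚ.sum-↭ (↭ₚ.map⁺ _ p)

signProduct-↭ : ∀ {S S'} → S ↭ S' → signProduct S ≡ signProduct S'
signProduct-↭ ↭.refl       = refl
signProduct-↭ (prep e p)   = cong (signℤ (sgn e) *_) (signProduct-↭ p)
signProduct-↭ {e ∷ f ∷ S} {f ∷ e ∷ S'} (swap e f p) =
  trans (cong (λ z → signℤ (sgn e) * (signℤ (sgn f) * z)) (signProduct-↭ p))
        (ℤ*.x∙yz≈y∙xz (signℤ (sgn e)) (signℤ (sgn f)) (signProduct S'))
signProduct-↭ (↭.trans p q) = trans (signProduct-↭ p) (signProduct-↭ q)

matches-↭ : ∀ {m} (G : SGraph m) x y {S S'} → S ↭ S' → matches G x y S ≡ matches G x y S'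
matches-↭ G x y p = cong and (Listₚ.map-cong
  (λ { (r , c) → cong (λ d → d ℕ.+ bit _ ℕ.+ bit _ ≡ᵇ 1) (degree-↭ (r , c) p) }) (vertices G))

weight-↭ : ∀ {m} (G : SGraph m) x y {S S'} → S ↭ S' → weight G x y S ≡ weight G x y S'
weight-↭ G x y p = cong₂ (λ b s → if b then s else + 0) (matches-↭ G x y p) (signProduct-↭ p)

transfer-↭ : ∀ {m L L' E E'} → L ≡ L' → E ↭ E' → transfer (mkG {m} L E) ≈ᴹ transfer (mkG L' E')
transfer-↭ {m} {L} {E = E} refl p x y = ∑⊆-↭ (weight (mkG {m} L E) x y) (weight-↭ (mkG L E) x y) p

degree-++ : ∀ S S' v → degree (S ++ S') v ≡ degree S v ℕ.+ degree S' v
degree-++ S S' v = trans (cong sum (Listₚ.map-++ _ S S')) (ℕLₚ.sum-++ (map _ S) (map _ S'))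

signProduct-++ : ∀ S S' → signProduct (S ++ S') ≡ signProduct S * signProduct S'
signProduct-++ []      S' = sym (ℤₚ.*-identityˡ _)
signProduct-++ (e ∷ S) S' =
  trans (cong (signℤ (sgn e) *_) (signProduct-++ S S')) (sym (ℤₚ.*-assoc (signℤ (sgn e)) _ _))

signProduct-shift : ∀ k S → signProduct (map (shiftEdge k) S) ≡ signProduct S
signProduct-shift k []      = refl
signProduct-shift k (e ∷ S) = cong (signℤ (sgn e) *_) (signProduct-shift k S)

degree-nonincident : ∀ S v → All (λ e → incident v e ≡ false) S → degree S v ≡ 0
degree-nonincident []      v []       = refl
degree-nonincident (e ∷ S) v (h ∷ hs) rewrite h = degree-nonincident S v hs

incident-otherColumn : ∀ r c e → (c ≡ᵇ c1 e) ≡ false → (c ≡ᵇ c2 e) ≡ false → incident (r , c) e ≡ false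
incident-otherColumn r c e h₁ h₂
  rewrite h₁ | h₂ | Boolₚ.∧-zeroʳ (r ≡ᵇ r1 e) | Boolₚ.∧-zeroʳ (r ≡ᵇ r2 e) = refl

InColumns : ℕ → Edge → Set
InColumns L e = c1 e ≤ L × c2 e ≤ L

degree-beyond : ∀ {L} S r c → All (InColumns L) S → L < c → degree S (r , c) ≡ 0
degree-beyond {L} S r c inS L<c = degree-nonincident S (r , c) (All.map (λ {e} → away {e}) inS)
  where
  away : ∀ {e} → InColumns L e → incident (r , c) e ≡ false
  away {e} (c1≤L , c2≤L) = incident-otherColumn r c e
    (>⇒≡ᵇ-false (ℕₚ.≤-<-trans c1≤L L<c)) (>⇒≡ᵇ-false (ℕₚ.≤-<-trans c2≤L L<c))

degree-shift-before : ∀ S r c k → c < k → degree (map (shiftEdge k) S) (r , c) ≡ 0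
degree-shift-before []      r c k c<k = refl
degree-shift-before (e ∷ S) r c k c<k
  rewrite incident-otherColumn r c (shiftEdge k e)
            (<⇒≡ᵇ-false (ℕₚ.<-≤-trans c<k (ℕₚ.m≤m+n k (c1 e))))
            (<⇒≡ᵇ-false (ℕₚ.<-≤-trans c<k (ℕₚ.m≤m+n k (c2 e))))
  = degree-shift-before S r c k c<k

degree-shift : ∀ S r c k → degree (map (shiftEdge k) S) (r , k ℕ.+ c) ≡ degree S (r , c)
degree-shift []      r c k = refl
degree-shift (e ∷ S) r c k
  rewrite +-≡ᵇ-cancelˡ k c (c1 e) | +-≡ᵇ-cancelˡ k c (c2 e) = cong (_ ℕ.+_) (degree-shift S r c k)

crossing : ℕ → ℕ → Edge
crossing L i = edge i L i (suc L) pos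

signProduct-crossing : ∀ L I → signProduct (map (crossing L) I) ≡ + 1
signProduct-crossing L []      = refl
signProduct-crossing L (i ∷ I) = trans (ℤₚ.*-identityˡ _) (signProduct-crossing L I)

count-support : ∀ {m} (v : Vec Bool m) B r →
  sum (map (λ i → bit ((r ≡ᵇ i) ∧ B)) (support v)) ≡ bit (B ∧ v ! r)
count-support []          B r       = cong bit (sym (Boolₚ.∧-zeroʳ B))
count-support (false ∷ v) B zero    =
  trans (sum-map-suc (support v)) (trans (sum-zeros (support v)) (cong bit (sym (Boolₚ.∧-zeroʳ B))))
count-support (false ∷ v) B (suc r) = trans (sum-map-suc (support v)) (count-support v B r)
count-support (true ∷ v)  B zero    =
  trans (cong (bit B ℕ.+_) (trans (sum-map-suc (support v)) (sum-zeros (support v))))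
        (trans (ℕₚ.+-identityʳ _) (cong bit (sym (Boolₚ.∧-identityʳ B))))
count-support (true ∷ v)  B (suc r) = trans (sum-map-suc (support v)) (count-support v B r)

degree-crossing : ∀ {m} (v : Vec Bool m) L r c →
  degree (map (crossing L) (support v)) (r , c) ≡ bit (((c ≡ᵇ L) ∨ (c ≡ᵇ suc L)) ∧ v ! r)
degree-crossing v L r c = begin
  degree (map (crossing L) (support v)) (r , c)
    ≡⟨ cong sum (Listₚ.map-∘ (support v)) ⟨
  sum (map (λ i → bit (incident (r , c) (crossing L i))) (support v))
    ≡⟨ cong sum (Listₚ.map-cong (λ i → cong bit (incident-crossing (r ≡ᵇ i) (c ≡ᵇ L) (c ≡ᵇ suc L))) (support v)) ⟩
  sum (map (λ i → bit ((r ≡ᵇ i) ∧ ((c ≡ᵇ L) ∨ (c ≡ᵇ suc L)))) (support v))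
    ≡⟨ count-support v ((c ≡ᵇ L) ∨ (c ≡ᵇ suc L)) r ⟩
  bit (((c ≡ᵇ L) ∨ (c ≡ᵇ suc L)) ∧ v ! r) ∎
  where
  incident-crossing : ∀ a b d → (if a ∧ b then true else a ∧ d) ≡ a ∧ (b ∨ d)
  incident-crossing false b     d = refl
  incident-crossing true  true  d = refl
  incident-crossing true  false d = refl

-- Every edge set of an adjoined graph is uniquely of this form; v marks the joining edges used.
glue : ∀ {m} → ℕ → List Edge → Vec Bool m → List Edge → List Edge
glue L S v S' = S ++ (map (crossing L) (support v) ++ map (shiftEdge (suc L)) S')

module _ {m : ℕ} (L L' : ℕ) (x z v : Vec Bool m) (S S' : List Edge) where

  load-glueˡ : ∀ r c → c ≤ L → load (suc (L ℕ.+ L')) x z (glue L S v S') (r , c) ≡ load L x v S (r , c)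
  load-glueˡ r c c≤L
    rewrite degree-++ S (map (crossing L) (support v) ++ map (shiftEdge (suc L)) S') (r , c)
          | degree-++ (map (crossing L) (support v)) (map (shiftEdge (suc L)) S') (r , c)
          | degree-shift-before S' r c (suc L) (s≤s c≤L)
          | degree-crossing v L r c
          | <⇒≡ᵇ-false {c} {suc L} (s≤s c≤L)
          | <⇒≡ᵇ-false {c} {suc (L ℕ.+ L')} (s≤s (ℕₚ.≤-trans c≤L (ℕₚ.m≤m+n L L')))
          | Boolₚ.∨-identityʳ (c ≡ᵇ L)
    = rearrange (degree S (r , c)) (bit ((c ≡ᵇ 0) ∧ x ! r)) (bit ((c ≡ᵇ L) ∧ v ! r))
    where
    rearrange : ∀ a b k → a ℕ.+ (k ℕ.+ 0) ℕ.+ b ℕ.+ 0 ≡ a ℕ.+ b ℕ.+ k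
    rearrange = ℕSolver.solve-∀

  load-glueʳ : All (InColumns L) S → ∀ r c →
    load (suc (L ℕ.+ L')) x z (glue L S v S') (r , suc (L ℕ.+ c)) ≡ load L' v z S' (r , c)
  load-glueʳ inS r c
    rewrite degree-++ S (map (crossing L) (support v) ++ map (shiftEdge (suc L)) S') (r , suc (L ℕ.+ c))
          | degree-++ (map (crossing L) (support v)) (map (shiftEdge (suc L)) S') (r , suc (L ℕ.+ c))
          | degree-beyond S r (suc (L ℕ.+ c)) inS (s≤s (ℕₚ.m≤m+n L c))
          | degree-shift S' r c (suc L)
          | degree-crossing v L r (suc (L ℕ.+ c))
          | >⇒≡ᵇ-false {suc (L ℕ.+ c)} {L} (s≤s (ℕₚ.m≤m+n L c))
          | +-≡ᵇ-self L c
          | +-≡ᵇ-cancelˡ L c L'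
    = rearrange (degree S' (r , c)) (bit ((c ≡ᵇ 0) ∧ v ! r)) (bit ((c ≡ᵇ L') ∧ z ! r))
    where
    rearrange : ∀ a b k → 0 ℕ.+ (b ℕ.+ a) ℕ.+ 0 ℕ.+ k ≡ a ℕ.+ b ℕ.+ k
    rearrange = ℕSolver.solve-∀

column-split : ∀ L L' {c} → c ≤ suc (L ℕ.+ L') → c ≤ L ⊎ Σ[ c' ∈ ℕ ] c' ≤ L' × c ≡ suc (L ℕ.+ c')
column-split L L' {c} c≤ with c ℕ.≤? L
... | yes c≤L = inj₁ c≤L
... | no  c≰L = inj₂ (c ∸ suc L , c'≤L' , sym (ℕₚ.m+[n∸m]≡n L<c))
  where
  L<c = ℕₚ.≰⇒> c≰L
  c'≤L' : c ∸ suc L ≤ L'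
  c'≤L' = ℕₚ.+-cancelˡ-≤ (suc L) _ L' (subst (_≤ suc (L ℕ.+ L')) (sym (ℕₚ.m+[n∸m]≡n L<c)) c≤)

module _ {m : ℕ} (L L' : ℕ) (E E' : List Edge) (x z v : Vec Bool m) (S S' : List Edge) where

  private
    G  = mkG {m} L E
    G' = mkG {m} L' E'
    GG = adjoin G G'
    L≤ : L ≤ suc (L ℕ.+ L')
    L≤ = ℕₚ.≤-trans (ℕₚ.m≤m+n L L') (ℕₚ.n≤1+n _)

  matches-glue : All (InColumns L) S →
    matches GG x z (glue L S v S') ≡ matches G x v S ∧ matches G' v z S'
  matches-glue inS = T-ext split join
    where
    split : T (matches GG x z (glue L S v S')) → T (matches G x v S ∧ matches G' v z S')
    split h = Equivalence.from Boolₚ.T-∧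
      ( matches⁻ G x v S (λ {r} {c} r<m c≤L →
          trans (sym (load-glueˡ L L' x z v S S' r c c≤L))
                (matches⁺ GG x z (glue L S v S') h r<m (ℕₚ.≤-trans c≤L L≤)))
      , matches⁻ G' v z S' (λ {r} {c} r<m c≤L' →
          trans (sym (load-glueʳ L L' x z v S S' inS r c))
                (matches⁺ GG x z (glue L S v S') h r<m (s≤s (ℕₚ.+-monoʳ-≤ L c≤L')))))
    join : T (matches G x v S ∧ matches G' v z S') → T (matches GG x z (glue L S v S'))
    join h = matches⁻ GG x z (glue L S v S') λ {r} {c} r<m c≤ → case column-split L L' c≤ of λ where
        (inj₁ c≤L) → trans (load-glueˡ L L' x z v S S' r c c≤L) (matches⁺ G x v S h₁ r<m c≤L)
        (inj₂ (c' , c'≤L' , refl)) → trans (load-glueʳ L L' x z v S S' inS r c') (matches⁺ G' v z S' h₂ r<m c'≤L')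
      where
      h₁ = proj₁ (Equivalence.to Boolₚ.T-∧ h)
      h₂ = proj₂ (Equivalence.to Boolₚ.T-∧ h)

  weight-glue : All (InColumns L) S →
    weight GG x z (glue L S v S') ≡ weight G x v S * weight G' v z S'
  weight-glue inS = begin
    weight GG x z (glue L S v S')
      ≡⟨ cong₂ (λ b s → if b then s else + 0) (matches-glue inS) signProduct-glue ⟩
    (if matches G x v S ∧ matches G' v z S' then signProduct S * signProduct S' else + 0)
      ≡⟨ if-∧-* (matches G x v S) (matches G' v z S') ⟩
    weight G x v S * weight G' v z S' ∎
    where
    signProduct-glue : signProduct (glue L S v S') ≡ signProduct S * signProduct S'
    signProduct-glue = begin
      signProduct (glue L S v S')
        ≡⟨ signProduct-++ S _ ⟩
      signProduct S * signProduct (map (crossing L) (support v) ++ map (shiftEdge (suc L)) S')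
        ≡⟨ cong (signProduct S *_) (signProduct-++ (map (crossing L) (support v)) _) ⟩
      signProduct S * (signProduct (map (crossing L) (support v)) * signProduct (map (shiftEdge (suc L)) S'))
        ≡⟨ cong₂ (λ a b → signProduct S * (a * b)) (signProduct-crossing L (support v)) (signProduct-shift (suc L) S') ⟩
      signProduct S * (+ 1 * signProduct S')
        ≡⟨ cong (signProduct S *_) (ℤₚ.*-identityˡ _) ⟩
      signProduct S * signProduct S' ∎
    if-∧-* : ∀ a b → (if a ∧ b then signProduct S * signProduct S' else + 0) ≡
                     (if a then signProduct S else + 0) * (if b then signProduct S' else + 0)
    if-∧-* true  true  = refl
    if-∧-* true  false = sym (ℤₚ.*-zeroʳ (signProduct S))
    if-∧-* false b     = refl

transfer-adjoin : ∀ {m} L L' (E E' : List Edge) → All (InColumns L) E →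
  transfer (adjoin (mkG {m} L E) (mkG L' E')) ≈ᴹ transfer (mkG L E) ⊙ transfer (mkG L' E')
transfer-adjoin {m} L L' E E' inE x z = begin
  ∑[ T ⊆ E ++ (map (crossing L) (upTo m) ++ map (shiftEdge (suc L)) E') ] w T
    ≡⟨ ∑⊆-++ E _ w ⟩
  ∑[ S ⊆ E ] ∑[ T ⊆ map (crossing L) (upTo m) ++ map (shiftEdge (suc L)) E' ] w (S ++ T)
    ≡⟨ ∑-cong (subsets E) (λ S → begin
         ∑[ T ⊆ map (crossing L) (upTo m) ++ map (shiftEdge (suc L)) E' ] w (S ++ T)
           ≡⟨ ∑⊆-++ (map (crossing L) (upTo m)) _ _ ⟩
         ∑[ K ⊆ map (crossing L) (upTo m) ] ∑[ T ⊆ map (shiftEdge (suc L)) E' ] w (S ++ (K ++ T))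
           ≡⟨ ∑⊆-map (crossing L) (upTo m) _ ⟩
         ∑[ I ⊆ upTo m ] ∑[ T ⊆ map (shiftEdge (suc L)) E' ] w (S ++ (map (crossing L) I ++ T))
           ≡⟨ ∑⊆-upTo m _ ⟩
         ∑[ v ∈𝔹^ m ] ∑[ T ⊆ map (shiftEdge (suc L)) E' ] w (S ++ (map (crossing L) (support v) ++ T))
           ≡⟨ ∑𝔹-cong m (λ v → ∑⊆-map (shiftEdge (suc L)) E' _) ⟩
         ∑[ v ∈𝔹^ m ] ∑[ S' ⊆ E' ] w (glue L S v S') ∎) ⟩
  ∑[ S ⊆ E ] ∑[ v ∈𝔹^ m ] ∑[ S' ⊆ E' ] w (glue L S v S')
    ≡⟨ ∑⊆-cong-All inE (λ S inS → ∑𝔹-cong m λ v →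
         trans (∑-cong (subsets E') (λ S' → weight-glue L L' E E' x z v S S' inS))
               (∑-*ˡ (subsets E') (weight G x v S) (weight G' v z))) ⟩
  ∑[ S ⊆ E ] ∑[ v ∈𝔹^ m ] weight G x v S * transfer G' v z
    ≡⟨ ∑-∑𝔹-comm (subsets E) m _ ⟩
  ∑[ v ∈𝔹^ m ] ∑[ S ⊆ E ] weight G x v S * transfer G' v z
    ≡⟨ ∑𝔹-cong m (λ v → ∑-*ʳ (subsets E) (transfer G' v z) (λ S → weight G x v S)) ⟩
  ∑[ v ∈𝔹^ m ] transfer G x v * transfer G' v z ∎
  where
  G  = mkG {m} L E
  G' = mkG {m} L' E'
  w  = weight (adjoin G G') x z

InColumns-adjoin : ∀ {m} L L' (E E' : List Edge) → All (InColumns L) E → All (InColumns L') E' →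
  All (InColumns (suc (L ℕ.+ L'))) (edges (adjoin (mkG {m} L E) (mkG L' E')))
InColumns-adjoin {m} L L' E E' inE inE' =
  Allₚ.++⁺ (All.map (λ (c1≤ , c2≤) → ℕₚ.≤-trans c1≤ L≤ , ℕₚ.≤-trans c2≤ L≤) inE)
    (Allₚ.++⁺ (Allₚ.map⁺ (Allₚ.applyUpTo⁺₂ id m (λ _ → L≤ , s≤s (ℕₚ.m≤m+n L L'))))
              (Allₚ.map⁺ (All.map (λ (c1≤ , c2≤) → shifted c1≤ , shifted c2≤) inE')))
  where
  L≤ : L ≤ suc (L ℕ.+ L')
  L≤ = ℕₚ.≤-trans (ℕₚ.m≤m+n L L') (ℕₚ.n≤1+n _)
  shifted : ∀ {c} → c ≤ L' → suc (L ℕ.+ c) ≤ suc (L ℕ.+ L')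
  shifted = s≤s ∘ ℕₚ.+-monoʳ-≤ L

deg₀ : List Edge → ℕ → ℕ
deg₀ S r = degree S (r , 0)

module _ {m : ℕ} where

  matches-column : ∀ E x y S → matches (mkG {m} 0 E) x y S ≡
    allBelow m (λ r → deg₀ S r ℕ.+ bit (x ! r) ℕ.+ bit (y ! r) ≡ᵇ 1)
  matches-column E x y S = T-ext
    (λ h → allBelow⁻ m _ λ r<m → ℕₚ.≡⇒≡ᵇ _ 1 (matches⁺ G x y S h r<m ℕ.z≤n))
    (λ h → matches⁻ G x y S λ { {c = zero} r<m _ → ℕₚ.≡ᵇ⇒≡ _ 1 (allBelow⁺ m _ h r<m) })
    where
    G = mkG {m} 0 E

  weight-column : ∀ E x y S → weight (mkG {m} 0 E) x y S ≡
    ⟦ allBelow m (λ r → deg₀ S r ℕ.+ bit (x ! r) ℕ.+ bit (y ! r) ≡ᵇ 1) ⟧ * signProduct S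
  weight-column E x y S rewrite sym (matches-column E x y S) = if-as-⟦⟧ _ (signProduct S)

emptyColumn : (m : ℕ) → SGraph m
emptyColumn m = mkG 0 []

exactlyOne : ∀ {m} → Vec Bool m → Vec Bool m → Bool
exactlyOne {m} x y = allBelow m (λ r → bit (x ! r) ℕ.+ bit (y ! r) ≡ᵇ 1)

⟦exactlyOne⟧ : ∀ {m} (x y : Vec Bool m) → ⟦ exactlyOne x y ⟧ ≡ δ (complement x) y
⟦exactlyOne⟧ []          []          = refl
⟦exactlyOne⟧ (false ∷ x) (false ∷ y) = refl
⟦exactlyOne⟧ (false ∷ x) (true ∷ y)  = ⟦exactlyOne⟧ x y
⟦exactlyOne⟧ (true ∷ x)  (false ∷ y) = ⟦exactlyOne⟧ x y
⟦exactlyOne⟧ (true ∷ x)  (true ∷ y)  = refl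

transfer-emptyColumn : ∀ {m} (x y : Vec Bool m) → transfer (emptyColumn m) x y ≡ ⟦ exactlyOne x y ⟧
transfer-emptyColumn x y =
  trans (ℤₚ.+-identityʳ _) (trans (weight-column [] x y []) (ℤₚ.*-identityʳ _))

module _ {m : ℕ} where

  N : Mat m
  N = transfer (emptyColumn m)

  N⊙ : ∀ (A : Mat m) x z → (N ⊙ A) x z ≡ A (complement x) z
  N⊙ A x z = trans (∑𝔹-cong m (λ y → cong (_* A y z) (trans (transfer-emptyColumn x y) (⟦exactlyOne⟧ x y))))
                   (∑𝔹-δˡ (complement x) (λ y → A y z))

  N⊙N : N ⊙ N ≈ᴹ δ
  N⊙N x z = begin
    (N ⊙ N) x z                        ≡⟨ N⊙ N x z ⟩
    N (complement x) z                 ≡⟨ trans (transfer-emptyColumn (complement x) z) (⟦exactlyOne⟧ (complement x) z) ⟩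
    δ (complement (complement x)) z    ≡⟨ cong (λ u → δ u z) (complement-involutive x) ⟩
    δ x z                              ∎

overlayMatches : ∀ {m} → Vec Bool m → List Edge → List Edge → Vec Bool m → Bool
overlayMatches {m} x S T w = allBelow m (λ r → deg₀ S r ℕ.+ bit (x ! r) ℕ.+ (deg₀ T r ℕ.+ bit (w ! r)) ≡ᵇ 1)

module _ {m : ℕ} (E E' : List Edge) (x w : Vec Bool m) where

  column⊙N⊙column : (transfer (mkG 0 E) ⊙ (N ⊙ transfer (mkG 0 E'))) x w ≡
    ∑[ S ⊆ E ] ∑[ T ⊆ E' ]
      ⟦ overlayMatches x S T w ⟧ * (signProduct S * signProduct T)
  column⊙N⊙column = begin
    ∑[ Y ∈𝔹^ m ] transfer (mkG 0 E) x Y * (N ⊙ transfer (mkG 0 E')) Y w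
      ≡⟨ ∑𝔹-cong m (λ Y → cong (transfer (mkG 0 E) x Y *_) (N⊙ (transfer (mkG 0 E')) Y w)) ⟩
    ∑[ Y ∈𝔹^ m ] (∑[ S ⊆ E ] w₁ S Y) * (∑[ T ⊆ E' ] w₂ T Y)
      ≡⟨ ∑𝔹-cong m (λ Y → trans (sym (∑-*ʳ (subsets E) _ (λ S → w₁ S Y)))
                                (∑-cong (subsets E) (λ S → sym (∑-*ˡ (subsets E') (w₁ S Y) (λ T → w₂ T Y))))) ⟩
    ∑[ Y ∈𝔹^ m ] ∑[ S ⊆ E ] ∑[ T ⊆ E' ] w₁ S Y * w₂ T Y
      ≡⟨ ∑-∑𝔹-comm (subsets E) m _ ⟨
    ∑[ S ⊆ E ] ∑[ Y ∈𝔹^ m ] ∑[ T ⊆ E' ] w₁ S Y * w₂ T Y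
      ≡⟨ ∑-cong (subsets E) (λ S → sym (∑-∑𝔹-comm (subsets E') m _)) ⟩
    ∑[ S ⊆ E ] ∑[ T ⊆ E' ] ∑[ Y ∈𝔹^ m ] w₁ S Y * w₂ T Y
      ≡⟨ ∑-cong (subsets E) (λ S → ∑-cong (subsets E') (sum-over-boundary S)) ⟩
    ∑[ S ⊆ E ] ∑[ T ⊆ E' ]
      ⟦ overlayMatches x S T w ⟧ * (signProduct S * signProduct T) ∎
    where
    w₁ : List Edge → Vec Bool m → ℤ
    w₁ S Y = weight (mkG 0 E) x Y S
    w₂ : List Edge → Vec Bool m → ℤ
    w₂ T Y = weight (mkG 0 E') (complement Y) w T
    sum-over-boundary : ∀ S T → ∑[ Y ∈𝔹^ m ] w₁ S Y * w₂ T Y ≡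
      ⟦ overlayMatches x S T w ⟧ * (signProduct S * signProduct T)
    sum-over-boundary S T = begin
      ∑[ Y ∈𝔹^ m ] w₁ S Y * w₂ T Y
        ≡⟨ ∑𝔹-cong m (λ Y → cong₂ _*_ (weight-column E x Y S)
                                      (trans (weight-column E' (complement Y) w T)
                                             (cong (λ b → ⟦ b ⟧ * signProduct T) (ok₂-complement Y)))) ⟩
      ∑[ Y ∈𝔹^ m ] (⟦ ok₁ Y ⟧ * signProduct S) * (⟦ ok₂ Y ⟧ * signProduct T)
        ≡⟨ ∑𝔹-cong m (λ Y → ℤ*.interchange ⟦ ok₁ Y ⟧ (signProduct S) ⟦ ok₂ Y ⟧ (signProduct T)) ⟩
      ∑[ Y ∈𝔹^ m ] (⟦ ok₁ Y ⟧ * ⟦ ok₂ Y ⟧) * (signProduct S * signProduct T)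
        ≡⟨ ∑𝔹-*ʳ m _ (λ Y → ⟦ ok₁ Y ⟧ * ⟦ ok₂ Y ⟧) ⟩
      (∑[ Y ∈𝔹^ m ] ⟦ ok₁ Y ⟧ * ⟦ ok₂ Y ⟧) * (signProduct S * signProduct T)
        ≡⟨ cong (_* (signProduct S * signProduct T))
             (∑𝔹-matchAcross m (λ r → deg₀ S r ℕ.+ bit (x ! r)) (λ r → deg₀ T r ℕ.+ bit (w ! r))) ⟩
      ⟦ overlayMatches x S T w ⟧ * (signProduct S * signProduct T) ∎
      where
      ok₁ ok₂ : Vec Bool m → Bool
      ok₁ Y = allBelow m (λ r → deg₀ S r ℕ.+ bit (x ! r) ℕ.+ bit (Y ! r) ≡ᵇ 1)
      ok₂ Y = allBelow m (λ r → deg₀ T r ℕ.+ bit (w ! r) ℕ.+ bit (not (Y ! r)) ≡ᵇ 1)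
      ok₂-complement : ∀ Y → allBelow m (λ r → deg₀ T r ℕ.+ bit (complement Y ! r) ℕ.+ bit (w ! r) ≡ᵇ 1) ≡ ok₂ Y
      ok₂-complement Y = allBelow-cong m λ {r} r<m → cong (_≡ᵇ 1) (begin
        deg₀ T r ℕ.+ bit (complement Y ! r) ℕ.+ bit (w ! r)
          ≡⟨ cong (λ b → deg₀ T r ℕ.+ bit b ℕ.+ bit (w ! r)) (complement-! Y r<m) ⟩
        deg₀ T r ℕ.+ bit (not (Y ! r)) ℕ.+ bit (w ! r)
          ≡⟨ ℕ+.xy∙z≈xz∙y (deg₀ T r) _ _ ⟩
        deg₀ T r ℕ.+ bit (w ! r) ℕ.+ bit (not (Y ! r)) ∎)

rung : Sign → ℕ → Edge
rung σ i = edge i 0 (suc i) 0 σ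

signProduct-positiveRungs : ∀ I → signProduct (map (rung pos) I) ≡ + 1
signProduct-positiveRungs []      = refl
signProduct-positiveRungs (i ∷ I) = trans (ℤₚ.*-identityˡ _) (signProduct-positiveRungs I)

-- Split off the first rung position i: taking both rungs at i covers vertex (i , 0) twice,
-- and taking exactly one of them gives two terms of opposite sign.
rungs-cancel : ∀ m (L : List ℕ) (c : ℕ → ℕ) → All (_< m) L →
  ∑[ I ⊆ L ] ∑[ J ⊆ L ]
    ⟦ allBelow m (λ r → deg₀ (map (rung pos) I) r ℕ.+ deg₀ (map (rung neg) J) r ℕ.+ c r ≡ᵇ 1) ⟧ *
    signProduct (map (rung neg) J)
  ≡ ⟦ allBelow m (λ r → c r ≡ᵇ 1) ⟧
rungs-cancel m []      c []           = trans (ℤₚ.+-identityʳ _) (trans (ℤₚ.+-identityʳ _) (ℤₚ.*-identityʳ _))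
rungs-cancel m (i ∷ L) c (i<m ∷ L<m) = begin
  ∑[ I ⊆ i ∷ L ] ∑[ J ⊆ i ∷ L ] G I J
    ≡⟨ ∑⊆-∷ i L _ ⟩
  (∑[ I ⊆ L ] ∑[ J ⊆ i ∷ L ] G I J) + (∑[ I ⊆ L ] ∑[ J ⊆ i ∷ L ] G (i ∷ I) J)
    ≡⟨ cong₂ _+_ (trans (∑-cong (subsets L) (λ I → ∑⊆-∷ i L (G I))) (∑-+ (subsets L) _ _))
                 (trans (∑-cong (subsets L) (λ I → ∑⊆-∷ i L (G (i ∷ I)))) (∑-+ (subsets L) _ _)) ⟩
  neither + onlyNeg + (onlyPos + both)
    ≡⟨ cong (_+_ (neither + onlyNeg)) (trans (cong (_+_ onlyPos) both≡0) (ℤₚ.+-identityʳ onlyPos)) ⟩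
  neither + onlyNeg + onlyPos
    ≡⟨ ℤₚ.+-assoc neither onlyNeg onlyPos ⟩
  neither + (onlyNeg + onlyPos)
    ≡⟨ trans (cong (_+_ neither) onlyNeg+onlyPos≡0) (ℤₚ.+-identityʳ neither) ⟩
  neither
    ≡⟨ rungs-cancel m L c L<m ⟩
  ⟦ allBelow m (λ r → c r ≡ᵇ 1) ⟧ ∎
  where
  G : List ℕ → List ℕ → ℤ
  G I J = ⟦ allBelow m (λ r → deg₀ (map (rung pos) I) r ℕ.+ deg₀ (map (rung neg) J) r ℕ.+ c r ≡ᵇ 1) ⟧ *
          signProduct (map (rung neg) J)
  neither onlyNeg onlyPos both : ℤ
  neither = ∑[ I ⊆ L ] ∑[ J ⊆ L ] G I J
  onlyNeg = ∑[ I ⊆ L ] ∑[ J ⊆ L ] G I (i ∷ J)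
  onlyPos = ∑[ I ⊆ L ] ∑[ J ⊆ L ] G (i ∷ I) J
  both    = ∑[ I ⊆ L ] ∑[ J ⊆ L ] G (i ∷ I) (i ∷ J)

  ≡ᵇ-refl : ∀ n → (n ≡ᵇ n) ≡ true
  ≡ᵇ-refl zero    = refl
  ≡ᵇ-refl (suc n) = ≡ᵇ-refl n

  both≡0 : both ≡ + 0
  both≡0 = trans (∑-cong (subsets L) λ I → trans (∑-cong (subsets L) (covered-twice I)) (∑-zero (subsets L)))
                 (∑-zero (subsets L))
    where
    covered-twice : ∀ I J → G (i ∷ I) (i ∷ J) ≡ + 0
    covered-twice I J = cong (λ b → ⟦ b ⟧ * signProduct (map (rung neg) (i ∷ J))) (allBelow-false m _ i<m (begin
      deg₀ (map (rung pos) (i ∷ I)) i ℕ.+ deg₀ (map (rung neg) (i ∷ J)) i ℕ.+ c i ≡ᵇ 1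
        ≡⟨ cong (λ b → bit b ℕ.+ dI ℕ.+ (bit b ℕ.+ dJ) ℕ.+ c i ≡ᵇ 1) (incident-rung i) ⟩
      suc dI ℕ.+ suc dJ ℕ.+ c i ≡ᵇ 1
        ≡⟨ cong (λ n → suc n ℕ.+ c i ≡ᵇ 1) (ℕₚ.+-suc dI dJ) ⟩
      false ∎))
      where
      dI = deg₀ (map (rung pos) I) i
      dJ = deg₀ (map (rung neg) J) i
      incident-rung : ∀ i → incident (i , 0) (rung pos i) ≡ true
      incident-rung i rewrite ≡ᵇ-refl i = refl

  onlyNeg+onlyPos≡0 : onlyNeg + onlyPos ≡ + 0
  onlyNeg+onlyPos≡0 =
    trans (sym (∑-+ (subsets L) _ _))
      (trans (∑-cong (subsets L) λ I → trans (sym (∑-+ (subsets L) _ _))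
               (trans (∑-cong (subsets L) (opposite I)) (∑-zero (subsets L))))
             (∑-zero (subsets L)))
    where
    opposite : ∀ I J → G I (i ∷ J) + G (i ∷ I) J ≡ + 0
    opposite I J = begin
      ⟦ ok ⟧ * (ℤ.- (+ 1) * s) + G (i ∷ I) J
        ≡⟨ cong (λ b → ⟦ b ⟧ * (ℤ.- (+ 1) * s) + G (i ∷ I) J)
             (allBelow-cong m λ {r} _ → cong (λ d → d ℕ.+ c r ≡ᵇ 1)
               (ℕ+.x∙yz≈yx∙z (deg₀ (map (rung pos) I) r) (bit (incident (r , 0) (rung pos i)))
                             (deg₀ (map (rung neg) J) r))) ⟩
      ⟦ ok′ ⟧ * (ℤ.- (+ 1) * s) + ⟦ ok′ ⟧ * s
        ≡⟨ cong (λ t → ⟦ ok′ ⟧ * t + ⟦ ok′ ⟧ * s) (ℤₚ.-1*i≡-i s) ⟩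
      ⟦ ok′ ⟧ * ℤ.- s + ⟦ ok′ ⟧ * s
        ≡⟨ cong (_+ ⟦ ok′ ⟧ * s) (ℤₚ.neg-distribʳ-* ⟦ ok′ ⟧ s) ⟨
      ℤ.- (⟦ ok′ ⟧ * s) + ⟦ ok′ ⟧ * s
        ≡⟨ ℤₚ.+-inverseˡ (⟦ ok′ ⟧ * s) ⟩
      + 0 ∎
      where
      s = signProduct (map (rung neg) J)
      ok ok′ : Bool
      ok  = allBelow m (λ r → deg₀ (map (rung pos) I) r ℕ.+ deg₀ (map (rung neg) (i ∷ J)) r ℕ.+ c r ≡ᵇ 1)
      ok′ = allBelow m (λ r → deg₀ (map (rung pos) (i ∷ I)) r ℕ.+ deg₀ (map (rung neg) J) r ℕ.+ c r ≡ᵇ 1)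

rungColumn : Sign → (m : ℕ) → SGraph m
rungColumn σ m = mkG 0 (map (rung σ) (upTo (m ∸ 1)))

module _ {m : ℕ} where

  P Q : Mat m
  P = transfer (rungColumn pos m)
  Q = transfer (rungColumn neg m)

  private
    L = upTo (m ∸ 1)

    L<m : All (_< m) L
    L<m = Allₚ.applyUpTo⁺₁ id (m ∸ 1) (λ i<m-1 → ℕₚ.<-≤-trans i<m-1 (ℕₚ.m∸n≤m m 1))

    rungs⊙N⊙rungs : ∀ σ τ x w → (transfer (rungColumn σ m) ⊙ (N ⊙ transfer (rungColumn τ m))) x w ≡
      ∑[ I ⊆ L ] ∑[ J ⊆ L ]
        ⟦ overlayMatches x (map (rung σ) I) (map (rung τ) J) w ⟧ *
        (signProduct (map (rung σ) I) * signProduct (map (rung τ) J))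
    rungs⊙N⊙rungs σ τ x w =
      trans (column⊙N⊙column (map (rung σ) L) (map (rung τ) L) x w)
            (trans (∑⊆-map (rung σ) L _) (∑-cong (subsets L) (λ I → ∑⊆-map (rung τ) L _)))

  P⊙N⊙Q : P ⊙ (N ⊙ Q) ≈ᴹ N
  P⊙N⊙Q x w = begin
    (P ⊙ (N ⊙ Q)) x w
      ≡⟨ rungs⊙N⊙rungs pos neg x w ⟩
    _
      ≡⟨ ∑-cong (subsets L) (λ I → ∑-cong (subsets L) λ J → cong₂ _*_
           (cong ⟦_⟧ (allBelow-cong m λ {r} _ → cong (_≡ᵇ 1)
             (ℕ+.interchange (deg₀ (map (rung pos) I) r) (bit (x ! r)) (deg₀ (map (rung neg) J) r) (bit (w ! r)))))
           (trans (cong (_* _) (signProduct-positiveRungs I)) (ℤₚ.*-identityˡ _))) ⟩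
    _
      ≡⟨ rungs-cancel m L (λ r → bit (x ! r) ℕ.+ bit (w ! r)) L<m ⟩
    ⟦ exactlyOne x w ⟧
      ≡⟨ transfer-emptyColumn x w ⟨
    N x w ∎

  Q⊙N⊙P : Q ⊙ (N ⊙ P) ≈ᴹ N
  Q⊙N⊙P x w = begin
    (Q ⊙ (N ⊙ P)) x w
      ≡⟨ rungs⊙N⊙rungs neg pos x w ⟩
    _
      ≡⟨ ∑-comm (subsets L) (subsets L) _ ⟩
    _
      ≡⟨ ∑-cong (subsets L) (λ J → ∑-cong (subsets L) λ I → cong₂ _*_
           (cong ⟦_⟧ (allBelow-cong m λ {r} _ → cong (_≡ᵇ 1) (rearrange (deg₀ (map (rung neg) I) r) (bit (x ! r))
                                                                       (deg₀ (map (rung pos) J) r) (bit (w ! r)))))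
           (trans (cong (signProduct (map (rung neg) I) *_) (signProduct-positiveRungs J)) (ℤₚ.*-identityʳ _))) ⟩
    _
      ≡⟨ rungs-cancel m L (λ r → bit (x ! r) ℕ.+ bit (w ! r)) L<m ⟩
    ⟦ exactlyOne x w ⟧
      ≡⟨ transfer-emptyColumn x w ⟨
    N x w ∎
    where
    rearrange : ∀ a b c d → a ℕ.+ b ℕ.+ (c ℕ.+ d) ≡ c ℕ.+ a ℕ.+ (b ℕ.+ d)
    rearrange a b c d = trans (ℕ+.interchange a b c d) (cong (ℕ._+ (b ℕ.+ d)) (ℕₚ.+-comm a c))

module _ {m : ℕ} where

  P⁻¹ : Mat m
  P⁻¹ = N ⊙ Q ⊙ N

  P⁻¹⊙P : P⁻¹ ⊙ P ≈ᴹ δ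
  P⁻¹⊙P = ≈ᴹ-trans (⊙-assoc (N ⊙ Q) N P)
            (≈ᴹ-trans (⊙-assoc N Q (N ⊙ P)) (≈ᴹ-trans (⊙-congˡ N Q⊙N⊙P) N⊙N))

  P⊙P⁻¹ : P ⊙ P⁻¹ ≈ᴹ δ
  P⊙P⁻¹ = ≈ᴹ-trans (≈ᴹ-sym (⊙-assoc P (N ⊙ Q) N)) (≈ᴹ-trans (⊙-congʳ N P⊙N⊙Q) N⊙N)

  open Powers (matrixMonoid m) public using (_^_; ^-sucʳ; ^-conjugate)
  open Powers.Invertible (matrixMonoid m) {P} {P⁻¹} P⁻¹⊙P P⊙P⁻¹ public using (a^-homo) renaming (a^_ to P^_)

InColumns-concatMap : ∀ {c} (f : ℕ → ℕ → Edge) n L → (∀ i {j} → j < n → InColumns c (f i j)) →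
  All (InColumns c) (concatMap (λ i → map (f i) (upTo n)) L)
InColumns-concatMap f n L h =
  Allₚ.concat⁺ (Allₚ.map⁺ (All.universal (λ i → Allₚ.map⁺ (Allₚ.applyUpTo⁺₁ id n (h i))) L))

module _ {m : ℕ} where

  private
    rows = upTo (m ∸ 1)

  rungsAt : Sign → ℕ → List Edge
  rungsAt σ c = map (λ i → edge i c (suc i) c σ) rows

  transfer-appendColumn : ∀ σ c {H V H' V'} → All (InColumns c) (H ++ V) →
    H' ↭ H ++ map (crossing c) (upTo m) → V' ↭ V ++ rungsAt σ (suc c) →
    transfer (mkG {m} (suc c) (H' ++ V')) ≈ᴹ transfer (mkG c (H ++ V)) ⊙ transfer (rungColumn σ m)
  transfer-appendColumn σ c {H} {V} inHV H↭ V↭ =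
    ≈ᴹ-trans (transfer-↭ (cong suc (sym (ℕₚ.+-identityʳ c)))
               (↭.trans (↭ₚ.++⁺ H↭ V↭)
               (↭.trans (interchange-↭ H _ V _)
                        (↭.↭-reflexive (cong (λ R → (H ++ V) ++ (map (crossing c) (upTo m) ++ R)) shiftedRungs)))))
             (transfer-adjoin c 0 (H ++ V) (map (rung σ) rows) inHV)
    where
    shiftedRungs : rungsAt σ (suc c) ≡ map (shiftEdge (suc c)) (map (rung σ) rows)
    shiftedRungs = trans (Listₚ.map-cong (λ i → cong (λ k → edge i k (suc i) k σ) (sym (ℕₚ.+-identityʳ (suc c)))) rows)
                         (Listₚ.map-∘ rows)

  InColumns-horizontal : ∀ {k L} → k ≤ L → All (InColumns L) (horizontalEdges m k)
  InColumns-horizontal {k} k≤L =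
    InColumns-concatMap _ k (upTo m) λ _ j<k → ℕₚ.<⇒≤ (ℕₚ.<-≤-trans j<k k≤L) , ℕₚ.≤-trans j<k k≤L

  InColumns-grid : ∀ k → All (InColumns k) (edges (Gr m (+ suc k)))
  InColumns-grid k = Allₚ.++⁺ (InColumns-horizontal ℕₚ.≤-refl)
    (InColumns-concatMap _ (suc k) rows λ _ j<1+k → ℕₚ.≤-pred j<1+k , ℕₚ.≤-pred j<1+k)

  transfer-grid : ∀ k → transfer (Gr m (+ suc k)) ≈ᴹ P ^ suc k
  transfer-grid zero = ≈ᴹ-trans
    (transfer-↭ refl (↭.↭-reflexive (cong₂ _++_ (concatMap-[] (upTo m)) (concatMap-singleton (rung pos) rows))))
    (≈ᴹ-sym (⊙-identityʳ P))
  transfer-grid (suc k) =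
    ≈ᴹ-trans (transfer-appendColumn pos k (InColumns-grid k)
               (concatMap-upTo-suc-↭ _ k (upTo m)) (concatMap-upTo-suc-↭ _ (suc k) rows))
    (≈ᴹ-trans (⊙-congʳ P (transfer-grid k)) (^-sucʳ P (suc k)))

  negativeVerticals : ℕ → List Edge
  negativeVerticals l = concatMap (λ i → map (λ j → edge i (suc j) (suc i) (suc j) neg) (upTo l)) rows

  negativeGrid : ℕ → SGraph m
  negativeGrid l = mkG l (horizontalEdges m l ++ negativeVerticals l)

  InColumns-negativeVerticals : ∀ {l L} → l ≤ L → All (InColumns L) (negativeVerticals l)
  InColumns-negativeVerticals l≤L = InColumns-concatMap _ _ rows λ _ j<l → ℕₚ.≤-trans j<l l≤L , ℕₚ.≤-trans j<l l≤L

  InColumns-negativeGrid : ∀ l → All (InColumns l) (edges (negativeGrid l))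
  InColumns-negativeGrid l = Allₚ.++⁺ (InColumns-horizontal ℕₚ.≤-refl) (InColumns-negativeVerticals ℕₚ.≤-refl)

  transfer-negativeGrid : ∀ l → transfer (negativeGrid l) ≈ᴹ N ⊙ Q ^ l
  transfer-negativeGrid zero = ≈ᴹ-trans
    (transfer-↭ refl (↭.↭-reflexive (cong₂ _++_ (concatMap-[] (upTo m)) (concatMap-[] rows))))
    (≈ᴹ-sym (⊙-identityʳ N))
  transfer-negativeGrid (suc l) =
    ≈ᴹ-trans (transfer-appendColumn neg l (InColumns-negativeGrid l)
               (concatMap-upTo-suc-↭ _ l (upTo m)) (concatMap-upTo-suc-↭ _ l rows))
    (≈ᴹ-trans (⊙-congʳ Q (transfer-negativeGrid l))
    (≈ᴹ-trans (⊙-assoc N (Q ^ l) Q) (⊙-congˡ N (^-sucʳ Q l))))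

  transfer-nonposGraph : ∀ l → transfer (nonposGraph m (suc l)) ≈ᴹ P⁻¹ ^ l
  transfer-nonposGraph l =
    ≈ᴹ-trans (transfer-↭ (cong suc (sym (ℕₚ.+-identityʳ l)))
               (↭.trans (↭ₚ.++⁺ʳ (negativeVerticals l) (concatMap-upTo-suc-↭ _ l (upTo m)))
               (↭.trans (↭.↭-reflexive (cong ((horizontalEdges m l ++ map (crossing l) (upTo m)) ++_)
                                              (sym (Listₚ.++-identityʳ (negativeVerticals l)))))
                        (interchange-↭ (horizontalEdges m l) _ (negativeVerticals l) []))))
    (≈ᴹ-trans (transfer-adjoin l 0 (edges (negativeGrid l)) [] (InColumns-negativeGrid l))
    (≈ᴹ-trans (⊙-congʳ N (transfer-negativeGrid l))
              (^-conjugate N⊙N Q l)))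

  InColumns-Gr : ∀ n → All (InColumns (lastCol (Gr m n))) (edges (Gr m n))
  InColumns-Gr (+ zero)   = Allₚ.++⁺ (InColumns-horizontal ℕₚ.≤-refl) (InColumns-negativeVerticals ℕ.z≤n)
  InColumns-Gr (+ suc k)  = InColumns-grid k
  InColumns-Gr -[1+ k ]   = Allₚ.++⁺ (InColumns-horizontal ℕₚ.≤-refl) (InColumns-negativeVerticals (ℕₚ.n≤1+n _))

  transfer-Gr : ∀ n → transfer (Gr m n) ≈ᴹ P^ n
  transfer-Gr (+ zero)  = transfer-nonposGraph 0
  transfer-Gr (+ suc k) = transfer-grid k
  transfer-Gr -[1+ k ]  = transfer-nonposGraph (suc k)

  transfer-foldl-adjoin : ∀ (G : SGraph m) a ns → All (InColumns (lastCol G)) (edges G) → transfer G ≈ᴹ P^ a →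
    transfer (foldl adjoin G (map (Gr m) ns)) ≈ᴹ P^ (foldl ℤ._+_ a ns)
  transfer-foldl-adjoin G a []       inG G≈Pᵃ = G≈Pᵃ
  transfer-foldl-adjoin G a (b ∷ ns) inG G≈Pᵃ = transfer-foldl-adjoin (adjoin G (Gr m b)) (a ℤ.+ b) ns
    (InColumns-adjoin (lastCol G) (lastCol (Gr m b)) (edges G) (edges (Gr m b)) inG (InColumns-Gr b))
    (≈ᴹ-trans (transfer-adjoin (lastCol G) (lastCol (Gr m b)) (edges G) (edges (Gr m b)) inG)
    (≈ᴹ-trans (⊙-cong G≈Pᵃ (transfer-Gr b)) (≈ᴹ-sym (a^-homo a b))))

mainTheorem3 : (m : ℕ) → 1 ≤ m → (ns : List⁺ ℤ) →
    M (adjoinAll m ns) ≡ M (Gr m (sum⁺ ns))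
mainTheorem3 m _ ns⁺@(n List⁺.∷ ns) = begin
  M (adjoinAll m ns⁺)                  ≡⟨ M-transfer (adjoinAll m ns⁺) ⟩
  transfer (adjoinAll m ns⁺) 0ᵛ 0ᵛ     ≡⟨ transfer-foldl-adjoin (Gr m n) n ns (InColumns-Gr n) (transfer-Gr n) 0ᵛ 0ᵛ ⟩
  (P^ sum⁺ ns⁺) 0ᵛ 0ᵛ                  ≡⟨ transfer-Gr (sum⁺ ns⁺) 0ᵛ 0ᵛ ⟨
  transfer (Gr m (sum⁺ ns⁺)) 0ᵛ 0ᵛ     ≡⟨ M-transfer (Gr m (sum⁺ ns⁺)) ⟨
  M (Gr m (sum⁺ ns⁺))                  ∎
  where
  0ᵛ = replicate m false
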